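{- The sequence $\left(\mathcal{G}\left(T_{\{2\}} \stackrel{k}{\cdot - \cdot} T_{\{2\}}\right)\right)_{k\ge1}$ is eventually periodic with preperiod of length $640$ and period $34$; that is, $\mathcal{G}\left(T_{\{2\}} \stackrel{k+34}{\cdot - \cdot} T_{\{2\}}\right)=\mathcal{G}\left(T_{\{2\}} \stackrel{k}{\cdot - \cdot} T_{\{2\}}\right)$ for all $k\ge 641$.
   Context: Node-Kayles is the impartial game on a finite simple graph $G$ in which a move chooses a vertex $v$ and deletes its closed neighbourhood $N_G[v]$; the Grundy value is $\mathcal{G}(\emptyset)=0$, $\mathcal{G}(G)=\mathrm{mex}\{\mathcal{G}(G\setminus N_G[v]) : v\in V(G)\}$, with $\mathrm{mex}(S)$ the least nonnegative integer not in $S$, and $\mathcal{G}(H\cup K)=\mathcal{G}(H)\oplus\mathcal{G}(K)$ for disjoint unions. $T_{\{2\}}$ is the path on three vertices rooted at its middle vertex. For $k\ge1$, $T_{\{2\}} \stackrel{k}{\cdot - \cdot} T_{\{2\}}$ is obtained from two disjoint copies of $T_{\{2\}}$ and a path with $k+1$ vertices (length $k$) by identifying the root of one copy with one endpoint of the path and the root of the other copy with the other endpoint. A sequence $(a_k)_{k\ge1}$ is eventually periodic with preperiod of length $p$ and period $q$ if $a_{k+q}=a_k$ for all $k>p$. -}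

module Defs where

open import Data.Nat using (ℕ; zero; suc; _+_; _≡ᵇ_; _<ᵇ_)
open import Data.Bool using (Bool; true; false; _∧_; _∨_; not; if_then_else_)
open import Data.Fin using (Fin; toℕ)
open import Data.List using (List; length; map; allFin; filterᵇ)
open import Data.Bool.ListAction using (any)
open import Data.Vec using (Vec; lookup; tabulate)

-- A finite graph on vertex set Fin size, given by a Boolean adjacency
-- relation.  (The concrete graphs below are simple: their adjacency is
-- symmetric and loop-free by construction.)
record Graph : Set where
  field
    size : ℕ
    adj  : Fin size → Fin size → Bool

-- mex: least natural number not in the list.  Since mex xs ≤ length xs,
-- scanning length xs + 1 candidates suffices.
mexAux : ℕ → ℕ → List ℕ → ℕ
mexAux zero    i xs = i
mexAux (suc f) i xs = if any (λ x → x ≡ᵇ i) xs then mexAux f (suc i) xs else i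

mex : List ℕ → ℕ
mex xs = mexAux (length xs) 0 xs

module NodeKayles (G : Graph) where
  open Graph G

  inClosedNbhd : Fin size → Fin size → Bool
  inClosedNbhd v u = (toℕ u ≡ᵇ toℕ v) ∨ adj v u

  -- Positions are induced subgraphs, given by the set of remaining vertices.
  Position : Set
  Position = Vec Bool size

  -- remaining vertices after playing v: S \ N_G[v]
  -- (for the induced subgraph G[S], N_{G[S]}[v] = N_G[v] ∩ S)
  play : Position → Fin size → Position
  play S v = tabulate (λ u → lookup S u ∧ not (inClosedNbhd v u))

  moves : Position → List (Fin size)
  moves S = filterᵇ (lookup S) (allFin size)

  -- Grundy value with fuel; each move removes at least one vertex, so
  -- fuel ≥ number of remaining vertices gives the true Grundy value.
  grundyF : ℕ → Position → ℕ
  grundyF zero    S = 0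
  grundyF (suc f) S = mex (map (λ v → grundyF f (play S v)) (moves S))

open NodeKayles public using (grundyF)

grundy : Graph → ℕ
grundy G = grundyF G (Graph.size G) (tabulate (λ _ → true))

-- T_{2} ·-k-· T_{2}: k + 5 vertices.  Path vertices 0,1,…,k
-- (edges i — i+1 for i < k); leaves k+1, k+2 attached to 0 (first
-- copy of T_{2}, rooted at 0); leaves k+3, k+4 attached to k.
dirEdge : ℕ → ℕ → ℕ → Bool
dirEdge k a b =
     ((b ≡ᵇ suc a) ∧ (b <ᵇ suc k))
  ∨ ((a ≡ᵇ 0) ∧ ((b ≡ᵇ k + 1) ∨ (b ≡ᵇ k + 2)))
  ∨ ((a ≡ᵇ k) ∧ ((b ≡ᵇ k + 3) ∨ (b ≡ᵇ k + 4)))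

T2pathT2 : ℕ → Graph
T2pathT2 k = record
  { size = k + 5
  ; adj  = λ u v → dirEdge k (toℕ u) (toℕ v) ∨ dirEdge k (toℕ v) (toℕ u)
  }

{-# OPTIONS --safe #-}
module Submission where

-- Deleting the closed neighbourhood of a vertex cuts T_{2} ·-k-· T_{2} into
-- "segments": subpaths of the spine, together with the two leaves at an end of
-- the spine when that end survives.  A spine move leaves two segments, a leaf
-- move leaves the twin leaf and one segment, and these parts are pairwise
-- non-adjacent, so by the Sprague–Grundy theorem the option values are
-- nim-sums of values of segments with leaves on at most one side: paths and
-- brooms (paths with two extra leaves at one end).
-- Tabulating these two sequences with period 34 (from 52, resp. 312 on) and
-- checking the recursion on an initial range determines them completely,
-- because once both parts of a spine move are long enough, lengthening the
-- segment by 34 does not change its set of option values.  The same shift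
-- argument gives the period of the whole graph for k ≥ 659; the remaining
-- range 641 ≤ k < 659 is checked by evaluation.

open import Data.Bool using (Bool; true; false; T; not; _∧_; _∨_; if_then_else_)
open import Data.Bool.ListAction using (any)
open import Data.Bool.Properties using (T-≡; T-∨; T-∧; ∧-identityʳ)
open import Data.Fin using (Fin; toℕ; fromℕ<)
import Data.Fin.Properties as Fin
open import Data.Fin.Subset using (Subset; _∈_; _∉_; _⊆_; _∪_; ∣_∣)
open import Data.Fin.Subset.Properties
  using (p⊂q⇒∣p∣<∣q∣; ⊆-antisym; ∪-comm; x∈p∪q⁺; x∈p∪q⁻; p⊆p∪q; q⊆p∪q; ∣p∣≤n; ∣p∣≤∣p∪q∣; ∣q∣≤∣p∪q∣)
open import Data.List using (List; []; _∷_; _++_; length; map; upTo; allFin)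
import Data.List as List
open import Data.List.Properties using (map-cong-local; filter-none)
import Data.List.Relation.Unary.All as All
import Data.List.Relation.Unary.Any as Any
open import Data.List.Relation.Unary.Any using (here; index)
open import Data.List.Relation.Unary.Any.Properties using (any⁺; any⁻; lookup-index)
open import Data.List.Membership.Propositional using () renaming (_∈_ to _∈ₗ_; _∉_ to _∉ₗ_)
open import Data.List.Membership.Propositional.Properties
  using (∈-map⁺; ∈-map⁻; ∈-++⁺ˡ; ∈-++⁺ʳ; ∈-++⁻; ∈-upTo⁺; ∈-upTo⁻; ∈-map∘filter⁻; ∈-map∘filter⁺; ∈-allFin; ∈-filter⁻)
open import Data.Nat
open import Data.Nat.Properties
open import Data.Nat.DivMod using (_%_; [m+n]%n≡m%n)
open import Data.Nat.Induction using (<-rec)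
open import Data.Parity.Base as ℙ using (Parity; 0ℙ; 1ℙ)
import Data.Parity.Properties as ℙₚ
open import Data.Product using (_×_; _,_; proj₁; proj₂; ∃-syntax)
open import Data.Product.Function.NonDependent.Propositional using (_×-⇔_)
open import Data.Sum using (_⊎_; inj₁; inj₂)
import Data.Sum as Sum
open import Data.Sum.Function.Propositional using (_⊎-⇔_)
open import Data.Unit using (tt)
open import Data.Vec using (lookup; tabulate)
open import Data.Vec.Properties using (lookup∘tabulate; []=⇒lookup; lookup⇒[]=)
open import Function using (_∘_; id; _⇔_; mk⇔; Equivalence)
open import Function.Construct.Composition using (_⇔-∘_)
open import Relation.Binary using (tri<; tri≈; tri>)
open import Relation.Binary.PropositionalEquality
open import Relation.Nullary using (¬_; contradiction; Dec; yes; no)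
open import Relation.Nullary.Decidable using (isYes; toWitness; fromWitness; _×-dec_; _⊎-dec_; _→-dec_; T?)
open import Relation.Unary using (Pred; Decidable; _≐_)
open import Defs

-- Nim-addition

bit : Parity → ℕ
bit 0ℙ = 0
bit 1ℙ = 1

-- consBit p q is the number with lowest binary digit p and higher digits q.
consBit : Parity → ℕ → ℕ
consBit p zero    = bit p
consBit p (suc q) = suc (suc (consBit p q))

parity-consBit : ∀ p q → parity (consBit p q) ≡ p
parity-consBit 0ℙ zero    = refl
parity-consBit 1ℙ zero    = refl
parity-consBit p  (suc q) = parity-consBit p q

⌊consBit/2⌋ : ∀ p q → ⌊ consBit p q /2⌋ ≡ q
⌊consBit/2⌋ 0ℙ zero    = refl
⌊consBit/2⌋ 1ℙ zero    = refl
⌊consBit/2⌋ p  (suc q) = cong suc (⌊consBit/2⌋ p q)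

consBit-parity-⌊/2⌋ : ∀ n → consBit (parity n) ⌊ n /2⌋ ≡ n
consBit-parity-⌊/2⌋ zero          = refl
consBit-parity-⌊/2⌋ (suc zero)    = refl
consBit-parity-⌊/2⌋ (suc (suc n)) = cong (suc ∘ suc) (consBit-parity-⌊/2⌋ n)

bit≤1 : ∀ p → bit p ≤ 1
bit≤1 0ℙ = z≤n
bit≤1 1ℙ = s≤s z≤n

consBit-< : ∀ {q s} p r → q < s → consBit p q < consBit r s
consBit-< {zero}  {suc s} p r _         = s≤s (≤-trans (bit≤1 p) (s≤s z≤n))
consBit-< {suc q} {suc s} p r (s≤s q<s) = s≤s (s≤s (consBit-< p r q<s))

consBit-0ℙ<1ℙ : ∀ q → consBit 0ℙ q < consBit 1ℙ q
consBit-0ℙ<1ℙ zero    = s≤s z≤n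
consBit-0ℙ<1ℙ (suc q) = s≤s (s≤s (consBit-0ℙ<1ℙ q))

consBit-<-cases : ∀ {p q r s} → consBit p q < consBit r s → q < s ⊎ (q ≡ s × p ≡ 0ℙ × r ≡ 1ℙ)
consBit-<-cases {p} {q} {r} {s} lt with <-cmp q s
... | tri< q<s _ _ = inj₁ q<s
... | tri> _ _ s<q = contradiction lt (<-asym (consBit-< r p s<q))
consBit-<-cases {0ℙ} {q} {0ℙ} lt | tri≈ _ refl _ = contradiction lt (<-irrefl refl)
consBit-<-cases {0ℙ} {q} {1ℙ} lt | tri≈ _ refl _ = inj₂ (refl , refl , refl)
consBit-<-cases {1ℙ} {q} {0ℙ} lt | tri≈ _ refl _ = contradiction lt (<-asym (consBit-0ℙ<1ℙ q))
consBit-<-cases {1ℙ} {q} {1ℙ} lt | tri≈ _ refl _ = contradiction lt (<-irrefl refl)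

-- Each recursive call halves the first argument.
xorFuel : ℕ → ℕ → ℕ → ℕ
xorFuel _       zero      b = b
xorFuel zero    a@(suc _) b = a
xorFuel (suc f) a@(suc _) b = consBit (parity a ℙ.+ parity b) (xorFuel f ⌊ a /2⌋ ⌊ b /2⌋)

infixl 6 _⊕_

_⊕_ : ℕ → ℕ → ℕ
a ⊕ b = xorFuel a a b

xorFuel-fuel : ∀ {f g} a b → a ≤ f → a ≤ g → xorFuel f a b ≡ xorFuel g a b
xorFuel-fuel zero b _ _ = refl
xorFuel-fuel {suc f} {suc g} a@(suc n) b (s≤s n≤f) (s≤s n≤g) =
  cong (consBit (parity a ℙ.+ parity b))
       (xorFuel-fuel ⌊ a /2⌋ ⌊ b /2⌋ (≤-trans ⌊a/2⌋≤n n≤f) (≤-trans ⌊a/2⌋≤n n≤g))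
  where
  ⌊a/2⌋≤n : ⌊ a /2⌋ ≤ n
  ⌊a/2⌋≤n = ≤-pred (⌊n/2⌋<n n)

⊕-unfold : ∀ a b → a ⊕ b ≡ consBit (parity a ℙ.+ parity b) (⌊ a /2⌋ ⊕ ⌊ b /2⌋)
⊕-unfold zero      b = sym (consBit-parity-⌊/2⌋ b)
⊕-unfold a@(suc n) b =
  cong (consBit (parity a ℙ.+ parity b)) (xorFuel-fuel ⌊ a /2⌋ ⌊ b /2⌋ (≤-pred (⌊n/2⌋<n n)) ≤-refl)

⊕-consBit : ∀ p q r s → consBit p q ⊕ consBit r s ≡ consBit (p ℙ.+ r) (q ⊕ s)
⊕-consBit p q r s
  rewrite ⊕-unfold (consBit p q) (consBit r s)
        | parity-consBit p q | parity-consBit r s | ⌊consBit/2⌋ p q | ⌊consBit/2⌋ r s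
  = refl

bitwise-induction : (P : ℕ → ℕ → Set) → P 0 0 →
                    (∀ p q r s → P q s → P (consBit p q) (consBit r s)) →
                    ∀ a b → P a b
bitwise-induction P base step a b = byFuel (suc (a + b)) a b ≤-refl
  where
  fromHalves : ∀ a b → P ⌊ a /2⌋ ⌊ b /2⌋ → P a b
  fromHalves a b = subst₂ P (consBit-parity-⌊/2⌋ a) (consBit-parity-⌊/2⌋ b) ∘ step _ _ _ _

  byFuel : ∀ n a b → a + b < n → P a b
  byFuel (suc n) zero    zero    _            = base
  byFuel (suc n) (suc a) b       (s≤s a+b<n) =
    fromHalves (suc a) b (byFuel n _ _ (<-≤-trans (+-mono-<-≤ (⌊n/2⌋<n a) (⌊n/2⌋≤n b)) a+b<n))
  byFuel (suc n) zero    (suc b) (s≤s b<n)   =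
    fromHalves zero (suc b) (byFuel n _ _ (<-≤-trans (⌊n/2⌋<n b) b<n))

ℙ-[p+q]+q≡p : ∀ p q → p ℙ.+ q ℙ.+ q ≡ p
ℙ-[p+q]+q≡p p q = trans (ℙₚ.+-assoc p q q) (trans (cong (p ℙ.+_) (ℙₚ.p+p≡0ℙ q)) (ℙₚ.+-identityʳ p))

[a⊕b]⊕b≡a : ∀ a b → a ⊕ b ⊕ b ≡ a
[a⊕b]⊕b≡a = bitwise-induction (λ a b → a ⊕ b ⊕ b ≡ a) refl step
  where
  open ≡-Reasoning
  step : ∀ p q r s → q ⊕ s ⊕ s ≡ q → consBit p q ⊕ consBit r s ⊕ consBit r s ≡ consBit p q
  step p q r s ih = begin
    consBit p q ⊕ consBit r s ⊕ consBit r s  ≡⟨ cong (_⊕ consBit r s) (⊕-consBit p q r s) ⟩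
    consBit (p ℙ.+ r) (q ⊕ s) ⊕ consBit r s  ≡⟨ ⊕-consBit (p ℙ.+ r) (q ⊕ s) r s ⟩
    consBit (p ℙ.+ r ℙ.+ r) (q ⊕ s ⊕ s)      ≡⟨ cong₂ consBit (ℙ-[p+q]+q≡p p r) ih ⟩
    consBit p q                              ∎

⊕-comm : ∀ a b → a ⊕ b ≡ b ⊕ a
⊕-comm = bitwise-induction (λ a b → a ⊕ b ≡ b ⊕ a) refl step
  where
  open ≡-Reasoning
  step : ∀ p q r s → q ⊕ s ≡ s ⊕ q → consBit p q ⊕ consBit r s ≡ consBit r s ⊕ consBit p q
  step p q r s ih = begin
    consBit p q ⊕ consBit r s  ≡⟨ ⊕-consBit p q r s ⟩
    consBit (p ℙ.+ r) (q ⊕ s)  ≡⟨ cong₂ consBit (ℙₚ.+-comm p r) ih ⟩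
    consBit (r ℙ.+ p) (s ⊕ q)  ≡⟨ ⊕-consBit r s p q ⟨
    consBit r s ⊕ consBit p q  ∎

[a⊕b]⊕a≡b : ∀ a b → a ⊕ b ⊕ a ≡ b
[a⊕b]⊕a≡b a b = trans (cong (_⊕ a) (⊕-comm a b)) ([a⊕b]⊕b≡a b a)

⊕-cancelʳ : ∀ {a c} b → c ⊕ b ≡ a ⊕ b → c ≡ a
⊕-cancelʳ {a} {c} b eq = trans (sym ([a⊕b]⊕b≡a c b)) (trans (cong (_⊕ b) eq) ([a⊕b]⊕b≡a a b))

<a⊕b⇒c⊕b<a⊎c⊕a<b : ∀ a b c → c < a ⊕ b → c ⊕ b < a ⊎ c ⊕ a < b
<a⊕b⇒c⊕b<a⊎c⊕a<b = bitwise-induction Lowerable (λ _ ()) step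
  where
  Lowerable : ℕ → ℕ → Set
  Lowerable a b = ∀ c → c < a ⊕ b → c ⊕ b < a ⊎ c ⊕ a < b

  step : ∀ p q r s → Lowerable q s → Lowerable (consBit p q) (consBit r s)
  step p q r s ih c c<a⊕b =
    subst Lowered (consBit-parity-⌊/2⌋ c)
          (lower (parity c) ⌊ c /2⌋ (subst (_< _) (sym (consBit-parity-⌊/2⌋ c)) c<a⊕b))
    where
    Lowered : ℕ → Set
    Lowered c = c ⊕ consBit r s < consBit p q ⊎ c ⊕ consBit p q < consBit r s

    lower : ∀ t u → consBit t u < consBit p q ⊕ consBit r s → Lowered (consBit t u)
    lower t u lt rewrite ⊕-consBit t u r s | ⊕-consBit t u p q | ⊕-consBit p q r s
      with consBit-<-cases lt
    ... | inj₁ u<q⊕s with ih u u<q⊕s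
    ...   | inj₁ u⊕s<q = inj₁ (consBit-< _ _ u⊕s<q)
    ...   | inj₂ u⊕q<s = inj₂ (consBit-< _ _ u⊕q<s)
    lower _ _ _ | inj₂ (refl , refl , p+r≡1ℙ) = lowerLowestBit p r p+r≡1ℙ
      where
      -- c agrees with a ⊕ b except that its lowest bit is 0; that bit is set in exactly one of a, b.
      lowerLowestBit : ∀ p r → p ℙ.+ r ≡ 1ℙ →
                       consBit r (q ⊕ s ⊕ s) < consBit p q ⊎ consBit p (q ⊕ s ⊕ q) < consBit r s
      lowerLowestBit 1ℙ 0ℙ _ rewrite [a⊕b]⊕b≡a q s = inj₁ (consBit-0ℙ<1ℙ q)
      lowerLowestBit 0ℙ 1ℙ _ rewrite [a⊕b]⊕a≡b q s = inj₂ (consBit-0ℙ<1ℙ s)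

-- Minimal excludants

IsMex : Pred ℕ _ → ℕ → Set
IsMex P m = ¬ P m × (∀ {c} → c < m → P c)

IsMex-unique : ∀ {P m n} → IsMex P m → IsMex P n → m ≡ n
IsMex-unique {m = m} {n} (∉m , <m) (∉n , <n) with <-cmp m n
... | tri< m<n _ _ = contradiction (<n m<n) ∉m
... | tri≈ _ m≡n _ = m≡n
... | tri> _ _ n<m = contradiction (<m n<m) ∉n

IsMex-resp : ∀ {P Q m} → P ≐ Q → IsMex P m → IsMex Q m
IsMex-resp (P⊆Q , Q⊆P) (∉m , <m) = ∉m ∘ Q⊆P , P⊆Q ∘ <m

∈⇒any : ∀ {c xs} → c ∈ₗ xs → T (any (λ x → x ≡ᵇ c) xs)
∈⇒any {c} = any⁺ _ ∘ Any.map (λ c≡x → ≡⇒≡ᵇ _ c (sym c≡x))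

any⇒∈ : ∀ {c} xs → T (any (λ x → x ≡ᵇ c) xs) → c ∈ₗ xs
any⇒∈ {c} xs = Any.map (λ x≡ᵇc → sym (≡ᵇ⇒≡ _ c x≡ᵇc)) ∘ any⁻ _ xs

mexAux-below : ∀ f {i c} xs → i ≤ c → c < mexAux f i xs → c ∈ₗ xs
mexAux-below zero    xs i≤c c<i = contradiction c<i (≤⇒≯ i≤c)
mexAux-below (suc f) {i} xs i≤c c<mex with any (λ x → x ≡ᵇ i) xs in i∈xs
... | false = contradiction c<mex (≤⇒≯ i≤c)
... | true with m≤n⇒m<n∨m≡n i≤c
...   | inj₁ i<c  = mexAux-below f xs i<c c<mex
...   | inj₂ refl = any⇒∈ xs (subst T (sym i∈xs) tt)

mexAux-∉⊎exhausted : ∀ f i xs → mexAux f i xs ∉ₗ xs ⊎ mexAux f i xs ≡ f + i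
mexAux-∉⊎exhausted zero    i xs = inj₂ refl
mexAux-∉⊎exhausted (suc f) i xs with any (λ x → x ≡ᵇ i) xs in i∈xs
... | false = inj₁ (λ i∈ → subst T i∈xs (∈⇒any i∈))
... | true with mexAux-∉⊎exhausted f (suc i) xs
...   | inj₁ ∉xs = inj₁ ∉xs
...   | inj₂ eq  = inj₂ (trans eq (+-suc f i))

-- Pigeonhole: the values 0, …, n - 1 sit at pairwise distinct positions of xs.
below-∈⇒≤length : ∀ {n} xs → (∀ {c} → c < n → c ∈ₗ xs) → n ≤ length xs
below-∈⇒≤length {n} xs below∈ = ≮⇒≥ λ len<n →
  let (i , j , i<j , same) = Fin.pigeonhole len<n position in
  Fin.<⇒≢ i<j (Fin.toℕ-injective (begin
    toℕ i                        ≡⟨ lookup-index (below∈ (Fin.toℕ<n i)) ⟩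
    List.lookup xs (position i)  ≡⟨ cong (List.lookup xs) same ⟩
    List.lookup xs (position j)  ≡⟨ lookup-index (below∈ (Fin.toℕ<n j)) ⟨
    toℕ j                        ∎))
  where
  open ≡-Reasoning
  position : Fin n → Fin (length xs)
  position i = index (below∈ (Fin.toℕ<n i))

mex-isMex : ∀ xs → IsMex (_∈ₗ xs) (mex xs)
mex-isMex xs = mex∉xs , mexAux-below (length xs) xs z≤n
  where
  mex∉xs : mex xs ∉ₗ xs
  mex∉xs mex∈xs with mexAux-∉⊎exhausted (length xs) 0 xs
  ... | inj₁ mex∉ = mex∉ mex∈xs
  ... | inj₂ mex≡len+0 = <-irrefl refl (below-∈⇒≤length xs all-below)
    where
    mex≡len : mex xs ≡ length xs
    mex≡len = trans mex≡len+0 (+-identityʳ _)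

    all-below : ∀ {c} → c < suc (length xs) → c ∈ₗ xs
    all-below c<1+len with m≤n⇒m<n∨m≡n (≤-pred c<1+len)
    ... | inj₁ c<len = mexAux-below (length xs) xs z≤n (subst (_ <_) (sym mex≡len) c<len)
    ... | inj₂ refl  = subst (_∈ₗ xs) mex≡len mex∈xs

-- Node-Kayles on an arbitrary graph

∈-tabulate⁺ : ∀ {n} {f : Fin n → Bool} {u} → f u ≡ true → u ∈ tabulate f
∈-tabulate⁺ {f = f} {u} fu = lookup⇒[]= u (tabulate f) (trans (lookup∘tabulate f u) fu)

∈-tabulate⁻ : ∀ {n} {f : Fin n → Bool} {u} → u ∈ tabulate f → f u ≡ true
∈-tabulate⁻ {f = f} {u} u∈ = trans (sym (lookup∘tabulate f u)) ([]=⇒lookup u∈)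

T-lookup⇒∈ : ∀ {n} {S : Subset n} {v} → T (lookup S v) → v ∈ S
T-lookup⇒∈ {S = S} {v} t = lookup⇒[]= v S (Equivalence.to T-≡ t)

∈⇒T-lookup : ∀ {n} {S : Subset n} {v} → v ∈ S → T (lookup S v)
∈⇒T-lookup v∈S = Equivalence.from T-≡ ([]=⇒lookup v∈S)

∧-not-≡-true : ∀ {a b} → a ∧ not b ≡ true → a ≡ true × b ≡ false
∧-not-≡-true {true} {false} _ = refl , refl

module _ (G : Graph) where
  open Graph G
  open NodeKayles G using (Position; play; moves; inClosedNbhd)

  grundyOf : Position → ℕ
  grundyOf S = grundyF G ∣ S ∣ S

  inClosedNbhd-refl : ∀ v → inClosedNbhd v v ≡ true
  inClosedNbhd-refl v = Equivalence.to T-≡ (Equivalence.from T-∨ (inj₁ (≡⇒≡ᵇ (toℕ v) (toℕ v) refl)))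

  ∈-play⁻ : ∀ {S : Position} {v u} → u ∈ play S v → u ∈ S × inClosedNbhd v u ≡ false
  ∈-play⁻ {S} {v} {u} u∈ with ∧-not-≡-true (∈-tabulate⁻ u∈)
  ... | Su≡true , far = lookup⇒[]= u S Su≡true , far

  ∈-play⁺ : ∀ {S : Position} {v u} → u ∈ S → inClosedNbhd v u ≡ false → u ∈ play S v
  ∈-play⁺ u∈S far = ∈-tabulate⁺ (cong₂ (λ a b → a ∧ not b) ([]=⇒lookup u∈S) far)

  play-⊆ : ∀ {S : Position} {v} → play S v ⊆ S
  play-⊆ {S} = proj₁ ∘ ∈-play⁻ {S}

  v∉play-v : ∀ S v → v ∉ play S v
  v∉play-v S v v∈ with () ← trans (sym (inClosedNbhd-refl v)) (proj₂ (∈-play⁻ {S} v∈))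

  ∣play∣<∣S∣ : ∀ {S : Position} {v} → v ∈ S → ∣ play S v ∣ < ∣ S ∣
  ∣play∣<∣S∣ {S} {v} v∈S = p⊂q⇒∣p∣<∣q∣ (play-⊆ {S} , v , v∈S , v∉play-v S v)

  play-shrinks : ∀ {S U : Position} {v} → v ∈ S → play S v ≡ U → ∣ U ∣ < ∣ S ∣
  play-shrinks {S} v∈S refl = ∣play∣<∣S∣ {S} v∈S

  ∈-moves⁻ : ∀ {S : Position} {v} → v ∈ₗ moves S → v ∈ S
  ∈-moves⁻ {S} v∈ = T-lookup⇒∈ (proj₂ (∈-filter⁻ (λ v → T? (lookup S v)) {xs = allFin size} v∈))

  ∣S∣≤0⇒moves≡[] : ∀ {S : Position} → ∣ S ∣ ≤ 0 → moves S ≡ []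
  ∣S∣≤0⇒moves≡[] {S} ∣S∣≤0 = filter-none (λ v → T? (lookup S v)) {xs = allFin size}
    (All.tabulate λ _ t → <⇒≱ (≤-<-trans z≤n (∣play∣<∣S∣ {S} (T-lookup⇒∈ t))) ∣S∣≤0)

  grundyF-suc : ∀ f S → ∣ S ∣ ≤ f → grundyF G (suc f) S ≡ grundyF G f S
  grundyF-suc zero S ∣S∣≤0 =
    cong (λ vs → mex (map (λ v → grundyF G 0 (play S v)) vs)) (∣S∣≤0⇒moves≡[] {S} ∣S∣≤0)
  grundyF-suc (suc f) S ∣S∣≤1+f = cong mex (map-cong-local {xs = moves S} (All.tabulate λ {v} v∈moves →
    grundyF-suc f (play S v) (≤-pred (≤-trans (∣play∣<∣S∣ {S} (∈-moves⁻ v∈moves)) ∣S∣≤1+f))))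

  grundyF-fuel : ∀ {f} S → ∣ S ∣ ≤ f → grundyF G f S ≡ grundyOf S
  grundyF-fuel {f} S ∣S∣≤f =
    subst (λ f → grundyF G f S ≡ grundyOf S) (m∸n+n≡m ∣S∣≤f) (extra (f ∸ ∣ S ∣))
    where
    extra : ∀ d → grundyF G (d + ∣ S ∣) S ≡ grundyOf S
    extra zero    = refl
    extra (suc d) = trans (grundyF-suc (d + ∣ S ∣) S (m≤n+m _ d)) (extra d)

  grundy≡grundyOf-all : grundy G ≡ grundyOf (tabulate λ _ → true)
  grundy≡grundyOf-all = grundyF-fuel {size} (tabulate λ _ → true) (∣p∣≤n (tabulate λ _ → true))

  OptionValue : Position → Pred ℕ _
  OptionValue S c = ∃[ v ] v ∈ S × grundyOf (play S v) ≡ c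

  grundyOf-isMex : ∀ S → IsMex (OptionValue S) (grundyOf S)
  grundyOf-isMex S = atFuel ∣ S ∣ refl
    where
    atFuel : ∀ f → ∣ S ∣ ≡ f → IsMex (OptionValue S) (grundyF G f S)
    atFuel zero    ∣S∣≡0   =
      (λ (_ , v∈S , _) → <⇒≢ (≤-<-trans z≤n (∣play∣<∣S∣ {S} v∈S)) (sym ∣S∣≡0)) , λ ()
    atFuel (suc f) ∣S∣≡1+f = IsMex-resp (toOption , fromOption) (mex-isMex (map value (moves S)))
      where
      value : Fin size → ℕ
      value v = grundyF G f (play S v)

      value≡ : ∀ {v} → v ∈ S → value v ≡ grundyOf (play S v)
      value≡ {v} v∈S =
        grundyF-fuel (play S v) (≤-pred (subst (∣ play S v ∣ <_) ∣S∣≡1+f (∣play∣<∣S∣ {S} v∈S)))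

      toOption : ∀ {c} → c ∈ₗ map value (moves S) → OptionValue S c
      toOption c∈ with ∈-map∘filter⁻ value (λ v → T? (lookup S v)) {xs = allFin size} c∈
      ... | v , _ , refl , t = v , T-lookup⇒∈ t , sym (value≡ (T-lookup⇒∈ t))

      fromOption : ∀ {c} → OptionValue S c → c ∈ₗ map value (moves S)
      fromOption (v , v∈S , refl) = ∈-map∘filter⁺ value (λ v → T? (lookup S v)) {xs = allFin size}
                                      (v , ∈-allFin v , sym (value≡ v∈S) , ∈⇒T-lookup v∈S)

  grundyOf-unique : ∀ {S m} → IsMex (OptionValue S) m → grundyOf S ≡ m
  grundyOf-unique {S} = IsMex-unique (grundyOf-isMex S)

  grundyOf-empty : ∀ {S : Position} → (∀ {u} → u ∉ S) → grundyOf S ≡ 0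
  grundyOf-empty empty = grundyOf-unique ((λ (_ , v∈S , _) → empty v∈S) , λ ())

  grundyOf-singleton : ∀ {S : Position} {x} → x ∈ S → (∀ {u} → u ∈ S → u ≡ x) → grundyOf S ≡ 1
  grundyOf-singleton {S} {x} x∈S only-x = grundyOf-unique (no-option-1 , λ { z<s → x , x∈S , after≡0 x∈S })
    where
    after≡0 : ∀ {v} → v ∈ S → grundyOf (play S v) ≡ 0
    after≡0 {v} v∈S = grundyOf-empty λ u∈ →
      v∉play-v S v (subst (_∈ play S v) (trans (only-x (play-⊆ {S} u∈)) (sym (only-x v∈S))) u∈)

    no-option-1 : ¬ OptionValue S 1
    no-option-1 (v , v∈S , value≡1) with () ← trans (sym (after≡0 v∈S)) value≡1

  Separated : Position → Position → Set
  Separated S T = ∀ {u v} → u ∈ S → v ∈ T → inClosedNbhd u v ≡ false × inClosedNbhd v u ≡ false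

  Separated-sym : ∀ {S T : Position} → Separated S T → Separated T S
  Separated-sym sep u∈T v∈S = let (uv , vu) = sep v∈S u∈T in vu , uv

  Separated-⊆ : ∀ {S T S₀ T₀ : Position} → S₀ ⊆ S → T₀ ⊆ T → Separated S T → Separated S₀ T₀
  Separated-⊆ S₀⊆S T₀⊆T sep u∈S₀ v∈T₀ = sep (S₀⊆S u∈S₀) (T₀⊆T v∈T₀)

  play-∪ˡ : ∀ {S T : Position} {v} → Separated S T → v ∈ S → play (S ∪ T) v ≡ play S v ∪ T
  play-∪ˡ {S} {T} {v} sep v∈S = ⊆-antisym forth back
    where
    forth : play (S ∪ T) v ⊆ play S v ∪ T
    forth u∈ with ∈-play⁻ {S ∪ T} u∈
    ... | u∈S∪T , far with x∈p∪q⁻ S T u∈S∪T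
    ...   | inj₁ u∈S = x∈p∪q⁺ (inj₁ (∈-play⁺ u∈S far))
    ...   | inj₂ u∈T = x∈p∪q⁺ (inj₂ u∈T)

    back : play S v ∪ T ⊆ play (S ∪ T) v
    back u∈ with x∈p∪q⁻ (play S v) T u∈
    ... | inj₁ u∈play = ∈-play⁺ {S ∪ T} (p⊆p∪q T (play-⊆ {S} u∈play)) (proj₂ (∈-play⁻ {S} u∈play))
    ... | inj₂ u∈T    = ∈-play⁺ {S ∪ T} (q⊆p∪q S T u∈T) (proj₁ (sep v∈S u∈T))

  play-∪ʳ : ∀ {S T : Position} {v} → Separated S T → v ∈ T → play (S ∪ T) v ≡ S ∪ play T v
  play-∪ʳ {S} {T} {v} sep v∈T = begin
    play (S ∪ T) v  ≡⟨ cong (λ U → play U v) (∪-comm S T) ⟩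
    play (T ∪ S) v  ≡⟨ play-∪ˡ (Separated-sym sep) v∈T ⟩
    play T v ∪ S    ≡⟨ ∪-comm (play T v) S ⟩
    S ∪ play T v    ∎
    where open ≡-Reasoning

  grundyOf-∪ : ∀ {S T : Position} → Separated S T → grundyOf (S ∪ T) ≡ grundyOf S ⊕ grundyOf T
  grundyOf-∪ {S} {T} = byFuel (suc ∣ S ∪ T ∣) ≤-refl
    where
    byFuel : ∀ n {S T : Position} → ∣ S ∪ T ∣ < n → Separated S T →
             grundyOf (S ∪ T) ≡ grundyOf S ⊕ grundyOf T
    byFuel (suc n) {S} {T} ∣S∪T∣<1+n sep = grundyOf-unique (no-option , options-below)
      where
      a = grundyOf S
      b = grundyOf T

      afterˡ : ∀ {v} → v ∈ S → grundyOf (play (S ∪ T) v) ≡ grundyOf (play S v) ⊕ b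
      afterˡ {v} v∈S rewrite play-∪ˡ sep v∈S =
        byFuel n {play S v} {T}
          (<-≤-trans (play-shrinks {S ∪ T} (p⊆p∪q T v∈S) (play-∪ˡ sep v∈S)) (≤-pred ∣S∪T∣<1+n))
          (Separated-⊆ (play-⊆ {S}) id sep)

      afterʳ : ∀ {v} → v ∈ T → grundyOf (play (S ∪ T) v) ≡ a ⊕ grundyOf (play T v)
      afterʳ {v} v∈T rewrite play-∪ʳ sep v∈T =
        byFuel n {S} {play T v}
          (<-≤-trans (play-shrinks {S ∪ T} (q⊆p∪q S T v∈T) (play-∪ʳ sep v∈T)) (≤-pred ∣S∪T∣<1+n))
          (Separated-⊆ id (play-⊆ {T}) sep)

      no-option : ¬ OptionValue (S ∪ T) (a ⊕ b)
      no-option (v , v∈S∪T , value≡) with x∈p∪q⁻ S T v∈S∪T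
      ... | inj₁ v∈S = proj₁ (grundyOf-isMex S) (v , v∈S , ⊕-cancelʳ b (trans (sym (afterˡ v∈S)) value≡))
      ... | inj₂ v∈T = proj₁ (grundyOf-isMex T)
        (v , v∈T , ⊕-cancelʳ a (trans (⊕-comm _ a) (trans (sym (afterʳ v∈T)) (trans value≡ (⊕-comm a b)))))

      options-below : ∀ {c} → c < a ⊕ b → OptionValue (S ∪ T) c
      options-below {c} c<a⊕b with <a⊕b⇒c⊕b<a⊎c⊕a<b a b c c<a⊕b
      ... | inj₁ c⊕b<a = let (v , v∈S , value≡) = proj₂ (grundyOf-isMex S) c⊕b<a in
        v , p⊆p∪q T v∈S , trans (afterˡ v∈S) (trans (cong (_⊕ b) value≡) ([a⊕b]⊕b≡a c b))
      ... | inj₂ c⊕a<b = let (v , v∈T , value≡) = proj₂ (grundyOf-isMex T) c⊕a<b in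
        v , q⊆p∪q S T v∈T ,
        trans (afterʳ v∈T) (trans (cong (a ⊕_) value≡) (trans (⊕-comm a (c ⊕ a)) ([a⊕b]⊕b≡a c a)))

  grundyOf-play-split : ∀ {S L R : Position} {v a b} → v ∈ S → play S v ≡ L ∪ R → Separated L R →
                        (∣ L ∣ < ∣ S ∣ → grundyOf L ≡ a) → (∣ R ∣ < ∣ S ∣ → grundyOf R ≡ b) →
                        grundyOf (play S v) ≡ a ⊕ b
  grundyOf-play-split {S} {L} {R} {v} {a} {b} v∈S split sep valueL valueR = begin
    grundyOf (play S v)      ≡⟨ cong grundyOf split ⟩
    grundyOf (L ∪ R)         ≡⟨ grundyOf-∪ sep ⟩
    grundyOf L ⊕ grundyOf R  ≡⟨ cong₂ _⊕_ (valueL (≤-<-trans (∣p∣≤∣p∪q∣ L R) ∣L∪R∣<∣S∣))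
                                          (valueR (≤-<-trans (∣q∣≤∣p∪q∣ L R) ∣L∪R∣<∣S∣)) ⟩
    a ⊕ b                    ∎
    where
    open ≡-Reasoning
    ∣L∪R∣<∣S∣ : ∣ L ∪ R ∣ < ∣ S ∣
    ∣L∪R∣<∣S∣ = play-shrinks {S} v∈S split

-- Adjacency in T_{2} ·-k-· T_{2}

T-≡ᵇ : ∀ {m n} → T (m ≡ᵇ n) ⇔ m ≡ n
T-≡ᵇ = mk⇔ (≡ᵇ⇒≡ _ _) (≡⇒≡ᵇ _ _)

T-<ᵇ : ∀ {m n} → T (m <ᵇ n) ⇔ m < n
T-<ᵇ = mk⇔ (<ᵇ⇒< _ _) <⇒<ᵇ

T-≡ᵇ-pair : ∀ {x a b} → T ((x ≡ᵇ a) ∨ (x ≡ᵇ b)) ⇔ (x ≡ a ⊎ x ≡ b)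
T-≡ᵇ-pair = (T-≡ᵇ ⊎-⇔ T-≡ᵇ) ⇔-∘ T-∨

¬T⇒≡false : ∀ {b} → ¬ T b → b ≡ false
¬T⇒≡false {false} _  = refl
¬T⇒≡false {true}  ¬t = contradiction tt ¬t

T-not-≡ᵇ : ∀ {m n} → T (not (m ≡ᵇ n)) ⇔ m ≢ n
T-not-≡ᵇ {m} {n} = mk⇔ (λ t m≡n → subst (T ∘ not) (Equivalence.to T-≡ (≡⇒≡ᵇ m n m≡n)) t)
                       (λ m≢n → subst (T ∘ not) (sym (¬T⇒≡false (m≢n ∘ ≡ᵇ⇒≡ m n))) tt)

T-keep : ∀ {b m n} → T (b ∧ not (m ≡ᵇ n)) ⇔ (T b × m ≢ n)
T-keep {b} = (mk⇔ id id ×-⇔ T-not-≡ᵇ) ⇔-∘ T-∧ {b}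

⟦_⟧ : ∀ {n} {P : ℕ → Set} → Decidable P → Subset n
⟦ P? ⟧ = tabulate (λ u → isYes (P? (toℕ u)))

∈⟦⟧⁻ : ∀ {n} {P : ℕ → Set} (P? : Decidable P) {u : Fin n} → u ∈ ⟦ P? ⟧ → P (toℕ u)
∈⟦⟧⁻ P? {u} u∈ = toWitness {a? = P? (toℕ u)} (Equivalence.from T-≡ (∈-tabulate⁻ u∈))

∈⟦⟧⁺ : ∀ {n} {P : ℕ → Set} (P? : Decidable P) {u : Fin n} → P (toℕ u) → u ∈ ⟦ P? ⟧
∈⟦⟧⁺ P? {u} p = ∈-tabulate⁺ (Equivalence.to T-≡ (fromWitness {a? = P? (toℕ u)} p))

pair-cases : ∀ {a b x y u : ℕ} → x ≡ a ⊎ x ≡ b → y ≡ a ⊎ y ≡ b → x ≢ y →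
             u ≡ a ⊎ u ≡ b → u ≡ x ⊎ u ≡ y
pair-cases (inj₁ refl) _           _   (inj₁ refl) = inj₁ refl
pair-cases _           (inj₁ refl) _   (inj₁ refl) = inj₂ refl
pair-cases (inj₂ refl) _           _   (inj₂ refl) = inj₁ refl
pair-cases _           (inj₂ refl) _   (inj₂ refl) = inj₂ refl
pair-cases (inj₁ refl) (inj₁ refl) x≢y _           = contradiction refl x≢y
pair-cases (inj₂ refl) (inj₂ refl) x≢y _           = contradiction refl x≢y

<pred⇒2+≤ : ∀ {u v} → u < pred v → suc (suc u) ≤ v
<pred⇒2+≤ {v = suc v} u<v-1 = s≤s u<v-1

<pred⇒< : ∀ {u v} → u < pred v → u < v
<pred⇒< u<v-1 = ≤-trans (n≤1+n _) (<pred⇒2+≤ u<v-1)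

module T2PathT2 (k : ℕ) where
  open NodeKayles (T2pathT2 k) using (Position; play; inClosedNbhd)

  LeftLeaf : Pred ℕ _
  LeftLeaf u = u ≡ k + 1 ⊎ u ≡ k + 2

  RightLeaf : Pred ℕ _
  RightLeaf u = u ≡ k + 3 ⊎ u ≡ k + 4

  Leaf : Pred ℕ _
  Leaf u = LeftLeaf u ⊎ RightLeaf u

  k<leaf : ∀ {u} → Leaf u → k < u
  k<leaf (inj₁ (inj₁ refl)) = m<m+n k z<s
  k<leaf (inj₁ (inj₂ refl)) = m<m+n k z<s
  k<leaf (inj₂ (inj₁ refl)) = m<m+n k z<s
  k<leaf (inj₂ (inj₂ refl)) = m<m+n k z<s

  ¬leftLeaf×rightLeaf : ∀ {x} → LeftLeaf x → ¬ RightLeaf x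
  ¬leftLeaf×rightLeaf (inj₁ refl) (inj₁ eq) with () ← +-cancelˡ-≡ k _ _ eq
  ¬leftLeaf×rightLeaf (inj₁ refl) (inj₂ eq) with () ← +-cancelˡ-≡ k _ _ eq
  ¬leftLeaf×rightLeaf (inj₂ refl) (inj₁ eq) with () ← +-cancelˡ-≡ k _ _ eq
  ¬leftLeaf×rightLeaf (inj₂ refl) (inj₂ eq) with () ← +-cancelˡ-≡ k _ _ eq

  data Edge : ℕ → ℕ → Set where
    path  : ∀ {a} → suc a ≤ k → Edge a (suc a)
    left  : ∀ {b} → LeftLeaf b → Edge 0 b
    right : ∀ {b} → RightLeaf b → Edge k b

  ClosedNbhd : ℕ → ℕ → Set
  ClosedNbhd x u = u ≡ x ⊎ Edge x u ⊎ Edge u x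

  T-dirEdge : ∀ {a b} → T (dirEdge k a b) ⇔ Edge a b
  T-dirEdge = mk⇔ toEdge fromEdge ⇔-∘ T-dirEdge-cases
    where
    EdgeCases : ℕ → ℕ → Set
    EdgeCases a b = (b ≡ suc a × b < suc k) ⊎ (a ≡ 0 × LeftLeaf b) ⊎ (a ≡ k × RightLeaf b)

    T-dirEdge-cases : ∀ {a b} → T (dirEdge k a b) ⇔ EdgeCases a b
    T-dirEdge-cases =
      (((T-≡ᵇ ×-⇔ T-<ᵇ) ⇔-∘ T-∧) ⊎-⇔
       ((((T-≡ᵇ ×-⇔ T-≡ᵇ-pair) ⇔-∘ T-∧) ⊎-⇔ ((T-≡ᵇ ×-⇔ T-≡ᵇ-pair) ⇔-∘ T-∧)) ⇔-∘ T-∨))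
      ⇔-∘ T-∨

    toEdge : ∀ {a b} → EdgeCases a b → Edge a b
    toEdge (inj₁ (refl , b<1+k))    = path (≤-pred b<1+k)
    toEdge (inj₂ (inj₁ (refl , l))) = left l
    toEdge (inj₂ (inj₂ (refl , r))) = right r

    fromEdge : ∀ {a b} → Edge a b → EdgeCases a b
    fromEdge (path 1+a≤k) = inj₁ (refl , s≤s 1+a≤k)
    fromEdge (left l)     = inj₂ (inj₁ (refl , l))
    fromEdge (right r)    = inj₂ (inj₂ (refl , r))

  T-inClosedNbhd : ∀ v u → T (inClosedNbhd v u) ⇔ ClosedNbhd (toℕ v) (toℕ u)
  T-inClosedNbhd v u = (T-≡ᵇ ⊎-⇔ ((T-dirEdge ⊎-⇔ T-dirEdge) ⇔-∘ T-∨)) ⇔-∘ T-∨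

  ClosedNbhd-sym : ∀ {x u} → ClosedNbhd x u → ClosedNbhd u x
  ClosedNbhd-sym (inj₁ refl)      = inj₁ refl
  ClosedNbhd-sym (inj₂ (inj₁ xu)) = inj₂ (inj₂ xu)
  ClosedNbhd-sym (inj₂ (inj₂ ux)) = inj₂ (inj₁ ux)

  edge-source≤k : ∀ {a b} → Edge a b → a ≤ k
  edge-source≤k (path 1+a≤k) = <⇒≤ 1+a≤k
  edge-source≤k (left _)     = z≤n
  edge-source≤k (right _)    = ≤-refl

  edge-within-path : ∀ {a b} → Edge a b → b ≤ k → b ≡ suc a
  edge-within-path (path _)  _   = refl
  edge-within-path (left l)  b≤k = contradiction b≤k (<⇒≱ (k<leaf (inj₁ l)))
  edge-within-path (right r) b≤k = contradiction b≤k (<⇒≱ (k<leaf (inj₂ r)))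

  edge-to-leftLeaf : ∀ {a b} → Edge a b → LeftLeaf b → a ≡ 0
  edge-to-leftLeaf (path 1+a≤k) l = contradiction 1+a≤k (<⇒≱ (k<leaf (inj₁ l)))
  edge-to-leftLeaf (left _)     _ = refl
  edge-to-leftLeaf (right r)    l = contradiction r (¬leftLeaf×rightLeaf l)

  edge-to-rightLeaf : ∀ {a b} → Edge a b → RightLeaf b → a ≡ k
  edge-to-rightLeaf (path 1+a≤k) r = contradiction 1+a≤k (<⇒≱ (k<leaf (inj₂ r)))
  edge-to-rightLeaf (left l)     r = contradiction r (¬leftLeaf×rightLeaf l)
  edge-to-rightLeaf (right _)    _ = refl

  far-path : ∀ {x u} → u ≤ k → suc (suc x) ≤ u → ¬ ClosedNbhd x u
  far-path u≤k x+2≤u (inj₁ refl) = 1+n≰n (≤-trans (n≤1+n _) x+2≤u)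
  far-path u≤k x+2≤u (inj₂ (inj₁ xu)) with refl ← edge-within-path xu u≤k = 1+n≰n (≤-pred x+2≤u)
  far-path {x} u≤k x+2≤u (inj₂ (inj₂ ux))
    with refl ← edge-within-path ux (≤-trans (≤-trans (n≤1+n x) (n≤1+n (suc x))) (≤-trans x+2≤u u≤k)) =
    1+n≰n (≤-trans (n≤1+n _) (≤-trans (n≤1+n _) x+2≤u))

  far-leftLeaf : ∀ {x u} → LeftLeaf x → u ≤ k → u ≢ 0 → ¬ ClosedNbhd x u
  far-leftLeaf lx u≤k u≢0 (inj₁ refl)      = <⇒≱ (k<leaf (inj₁ lx)) u≤k
  far-leftLeaf lx u≤k u≢0 (inj₂ (inj₁ xu)) = <⇒≱ (k<leaf (inj₁ lx)) (edge-source≤k xu)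
  far-leftLeaf lx u≤k u≢0 (inj₂ (inj₂ ux)) = u≢0 (edge-to-leftLeaf ux lx)

  far-rightLeaf : ∀ {x u} → RightLeaf x → u ≤ k → u ≢ k → ¬ ClosedNbhd x u
  far-rightLeaf rx u≤k u≢k (inj₁ refl)      = <⇒≱ (k<leaf (inj₂ rx)) u≤k
  far-rightLeaf rx u≤k u≢k (inj₂ (inj₁ xu)) = <⇒≱ (k<leaf (inj₂ rx)) (edge-source≤k xu)
  far-rightLeaf rx u≤k u≢k (inj₂ (inj₂ ux)) = u≢k (edge-to-rightLeaf ux rx)

  far-leaves : ∀ {x u} → Leaf x → Leaf u → x ≢ u → ¬ ClosedNbhd x u
  far-leaves lx lu x≢u (inj₁ refl)      = x≢u refl
  far-leaves lx lu x≢u (inj₂ (inj₁ xu)) = <⇒≱ (k<leaf lx) (edge-source≤k xu)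
  far-leaves lx lu x≢u (inj₂ (inj₂ ux)) = <⇒≱ (k<leaf lu) (edge-source≤k ux)

  Apart : (ℕ → Set) → (ℕ → Set) → Set
  Apart P Q = ∀ {x y} → P x → Q y → ¬ ClosedNbhd x y

  ¬ClosedNbhd⇒≡false : ∀ {v u} → ¬ ClosedNbhd (toℕ v) (toℕ u) → inClosedNbhd v u ≡ false
  ¬ClosedNbhd⇒≡false {v} {u} far = ¬T⇒≡false (far ∘ Equivalence.to (T-inClosedNbhd v u))

  ≡false⇒¬ClosedNbhd : ∀ {v u} → inClosedNbhd v u ≡ false → ¬ ClosedNbhd (toℕ v) (toℕ u)
  ≡false⇒¬ClosedNbhd {v} {u} ≡false close = subst T ≡false (Equivalence.from (T-inClosedNbhd v u) close)

  Apart⇒Separated : ∀ {P Q : ℕ → Set} (P? : Decidable P) (Q? : Decidable Q) →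
                    Apart P Q → Separated (T2pathT2 k) ⟦ P? ⟧ ⟦ Q? ⟧
  Apart⇒Separated P? Q? apart {u} {v} u∈ v∈ =
    ¬ClosedNbhd⇒≡false {u} {v} far , ¬ClosedNbhd⇒≡false {v} {u} (far ∘ ClosedNbhd-sym)
    where
    far : ¬ ClosedNbhd (toℕ u) (toℕ v)
    far = apart (∈⟦⟧⁻ P? u∈) (∈⟦⟧⁻ Q? v∈)

  play-⟦⟧ : ∀ {P Q R : ℕ → Set} (P? : Decidable P) (Q? : Decidable Q) (R? : Decidable R) v →
            (∀ {u} → P u → ¬ ClosedNbhd (toℕ v) u → Q u ⊎ R u) →
            (∀ {u} → Q u ⊎ R u → P u × ¬ ClosedNbhd (toℕ v) u) →
            play ⟦ P? ⟧ v ≡ ⟦ Q? ⟧ ∪ ⟦ R? ⟧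
  play-⟦⟧ P? Q? R? v split join = ⊆-antisym forth back
    where
    forth : play ⟦ P? ⟧ v ⊆ ⟦ Q? ⟧ ∪ ⟦ R? ⟧
    forth {u} u∈ with ∈-play⁻ (T2pathT2 k) {⟦ P? ⟧} u∈
    ... | u∈P , far with split (∈⟦⟧⁻ P? u∈P) (≡false⇒¬ClosedNbhd {v} {u} far)
    ...   | inj₁ q = x∈p∪q⁺ (inj₁ (∈⟦⟧⁺ Q? q))
    ...   | inj₂ r = x∈p∪q⁺ (inj₂ (∈⟦⟧⁺ R? r))
    back : ⟦ Q? ⟧ ∪ ⟦ R? ⟧ ⊆ play ⟦ P? ⟧ v
    back {u} u∈ with join (Sum.map (∈⟦⟧⁻ Q?) (∈⟦⟧⁻ R?) (x∈p∪q⁻ ⟦ Q? ⟧ ⟦ R? ⟧ u∈))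
    ... | p , far = ∈-play⁺ (T2pathT2 k) (∈⟦⟧⁺ P? p) (¬ClosedNbhd⇒≡false {v} {u} far)

  InSegment : ℕ → ℕ → Bool → Bool → ℕ → Set
  InSegment i j l r u = (i ≤ u × u < j) ⊎ (T l × LeftLeaf u) ⊎ (T r × RightLeaf u)

  pattern onPath i≤u u<j = inj₁ (i≤u , u<j)
  pattern onLeft l lu    = inj₂ (inj₁ (l , lu))
  pattern onRight r ru   = inj₂ (inj₂ (r , ru))

  inSegment? : ∀ i j l r → Decidable (InSegment i j l r)
  inSegment? i j l r u =
    (i ≤? u ×-dec u <? j) ⊎-dec (T? l ×-dec pair? (k + 1) (k + 2)) ⊎-dec (T? r ×-dec pair? (k + 3) (k + 4))
    where
    pair? : ∀ a b → Dec (u ≡ a ⊎ u ≡ b)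
    pair? a b = (u ≟ a) ⊎-dec (u ≟ b)

  segment : ℕ → ℕ → Bool → Bool → Position
  segment i j l r = ⟦ inSegment? i j l r ⟧

  record WellFormed (i j : ℕ) (l r : Bool) : Set where
    field
      j≤1+k       : j ≤ suc k
      left⇒i≡0    : T l → i ≡ 0
      right⇒j≡1+k : T r → j ≡ suc k

  -- Playing the root of a pair of leaves removes the pair.
  keepLeft : ℕ → Bool → Bool
  keepLeft v l = l ∧ not (v ≡ᵇ 0)

  keepRight : ℕ → Bool → Bool
  keepRight v r = r ∧ not (v ≡ᵇ k)

  keepLeft⇒ : ∀ {x l} → T (keepLeft x l) → T l
  keepLeft⇒ {x} {l} = proj₁ ∘ Equivalence.to (T-keep {l} {x} {0})

  keepRight⇒ : ∀ {x r} → T (keepRight x r) → T r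
  keepRight⇒ {x} {r} = proj₁ ∘ Equivalence.to (T-keep {r} {x} {k})

  leftLeaf≢rightLeaf : ∀ {x y} → LeftLeaf x → RightLeaf y → x ≢ y
  leftLeaf≢rightLeaf lx ry refl = ¬leftLeaf×rightLeaf lx ry

  module PathMove {i j : ℕ} {l r : Bool} {v : ℕ} (wf : WellFormed i j l r) (i≤v : i ≤ v) (v<j : v < j) where
    open WellFormed wf

    LeftPart : ℕ → Set
    LeftPart = InSegment i (pred v) (keepLeft v l) false

    RightPart : ℕ → Set
    RightPart = InSegment (suc (suc v)) j false (keepRight v r)

    v≤k : v ≤ k
    v≤k = ≤-pred (≤-trans v<j j≤1+k)

    split : ∀ {u} → InSegment i j l r u → ¬ ClosedNbhd v u → LeftPart u ⊎ RightPart u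
    split {u} (onPath i≤u u<j) far with <-cmp u v
    ... | tri≈ _ refl _ = contradiction (inj₁ refl) far
    ... | tri< u<v _ _ with m≤n⇒m<n∨m≡n u<v
    ...   | inj₁ 1+u<v  = inj₁ (onPath i≤u (<⇒≤pred 1+u<v))
    ...   | inj₂ refl   = contradiction (inj₂ (inj₂ (path v≤k))) far
    split {u} (onPath i≤u u<j) far | tri> _ _ v<u with m≤n⇒m<n∨m≡n v<u
    ...   | inj₁ 1+v<u  = inj₂ (onPath 1+v<u u<j)
    ...   | inj₂ refl   = contradiction (inj₂ (inj₁ (path (≤-pred (≤-trans u<j j≤1+k))))) far
    split (onLeft tl lu) far with v ≟ 0
    ... | yes refl = contradiction (inj₂ (inj₁ (left lu))) far
    ... | no v≢0   = inj₁ (onLeft (Equivalence.from T-keep (tl , v≢0)) lu)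
    split (onRight tr ru) far with v ≟ k
    ... | yes refl = contradiction (inj₂ (inj₁ (right ru))) far
    ... | no v≢k   = inj₂ (onRight (Equivalence.from T-keep (tr , v≢k)) ru)

    join : ∀ {u} → LeftPart u ⊎ RightPart u → InSegment i j l r u × ¬ ClosedNbhd v u
    join (inj₁ (onPath i≤u u<v-1)) =
      onPath i≤u (<-trans (<pred⇒< u<v-1) v<j) ,
      far-path v≤k (<pred⇒2+≤ u<v-1) ∘ ClosedNbhd-sym
    join (inj₁ (onLeft tl lu)) with Equivalence.to T-keep tl
    ... | tl , v≢0 = onLeft tl lu , far-leftLeaf lu v≤k v≢0 ∘ ClosedNbhd-sym
    join (inj₂ (onPath v+2≤u u<j)) =
      onPath (≤-trans i≤v (≤-trans (n≤1+n v) (≤-trans (n≤1+n (suc v)) v+2≤u))) u<j ,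
      far-path (≤-pred (≤-trans u<j j≤1+k)) v+2≤u
    join (inj₂ (onRight tr ru)) with Equivalence.to T-keep tr
    ... | tr , v≢k = onRight tr ru , far-rightLeaf ru v≤k v≢k ∘ ClosedNbhd-sym

    apart : Apart LeftPart RightPart
    apart (onPath _ x<v-1) (onPath v+2≤y y<j) =
      far-path (≤-pred (≤-trans y<j j≤1+k))
               (≤-trans (<pred⇒2+≤ x<v-1) (≤-trans (n≤1+n v) (≤-trans (n≤1+n (suc v)) v+2≤y)))
    apart (onPath _ x<v-1) (onRight _ ry) =
      far-rightLeaf ry (<⇒≤ x<k) (<⇒≢ x<k) ∘ ClosedNbhd-sym
      where
      x<k = <-≤-trans (<pred⇒< x<v-1) v≤k
    apart (onLeft _ lx) (onPath v+2≤y y<j) =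
      far-leftLeaf lx (≤-pred (≤-trans y<j j≤1+k)) (m<n⇒n≢0 v+2≤y)
    apart (onLeft _ lx) (onRight _ ry) = far-leaves (inj₁ lx) (inj₂ ry) (leftLeaf≢rightLeaf lx ry)

  module LeftLeafMove {j : ℕ} {r : Bool} {x x′ : ℕ} (j≤1+k : j ≤ suc k)
                      (lx : LeftLeaf x) (lx′ : LeftLeaf x′) (x≢x′ : x ≢ x′) where

    split : ∀ {u} → InSegment 0 j true r u → ¬ ClosedNbhd x u → u ≡ x′ ⊎ InSegment 1 j false r u
    split {u} (onPath _ u<j) far with u ≟ 0
    ... | yes refl = contradiction (inj₂ (inj₂ (left lx))) far
    ... | no u≢0   = inj₂ (onPath (n≢0⇒n>0 u≢0) u<j)
    split (onLeft _ lu) far with pair-cases lx lx′ x≢x′ lu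
    ... | inj₁ u≡x  = contradiction (inj₁ u≡x) far
    ... | inj₂ u≡x′ = inj₁ u≡x′
    split (onRight tr ru) far = inj₂ (onRight tr ru)

    join : ∀ {u} → u ≡ x′ ⊎ InSegment 1 j false r u → InSegment 0 j true r u × ¬ ClosedNbhd x u
    join (inj₁ refl) = onLeft _ lx′ , far-leaves (inj₁ lx) (inj₁ lx′) x≢x′
    join (inj₂ (onPath 1≤u u<j)) =
      onPath z≤n u<j , far-leftLeaf lx (≤-pred (≤-trans u<j j≤1+k)) (m<n⇒n≢0 1≤u)
    join (inj₂ (onRight tr ru)) = onRight tr ru , far-leaves (inj₁ lx) (inj₂ ru) (leftLeaf≢rightLeaf lx ru)

    apart : Apart (_≡ x′) (InSegment 1 j false r)
    apart refl (onPath 1≤y y<j) = far-leftLeaf lx′ (≤-pred (≤-trans y<j j≤1+k)) (m<n⇒n≢0 1≤y)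
    apart refl (onRight _ ry)   = far-leaves (inj₁ lx′) (inj₂ ry) (leftLeaf≢rightLeaf lx′ ry)

  module RightLeafMove {i : ℕ} {l : Bool} {x x′ : ℕ}
                       (rx : RightLeaf x) (rx′ : RightLeaf x′) (x≢x′ : x ≢ x′) where

    split : ∀ {u} → InSegment i (suc k) l true u → ¬ ClosedNbhd x u → InSegment i k l false u ⊎ u ≡ x′
    split {u} (onPath i≤u u<1+k) far with u ≟ k
    ... | yes refl = contradiction (inj₂ (inj₂ (right rx))) far
    ... | no u≢k   = inj₁ (onPath i≤u (≤∧≢⇒< (≤-pred u<1+k) u≢k))
    split (onLeft tl lu) far = inj₁ (onLeft tl lu)
    split (onRight _ ru) far with pair-cases rx rx′ x≢x′ ru
    ... | inj₁ u≡x  = contradiction (inj₁ u≡x) far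
    ... | inj₂ u≡x′ = inj₂ u≡x′

    join : ∀ {u} → InSegment i k l false u ⊎ u ≡ x′ → InSegment i (suc k) l true u × ¬ ClosedNbhd x u
    join (inj₁ (onPath i≤u u<k)) = onPath i≤u (≤-trans u<k (n≤1+n k)) , far-rightLeaf rx (<⇒≤ u<k) (<⇒≢ u<k)
    join (inj₁ (onLeft tl lu))   = onLeft tl lu , far-leaves (inj₂ rx) (inj₁ lu) (leftLeaf≢rightLeaf lu rx ∘ sym)
    join (inj₂ refl)             = onRight _ rx′ , far-leaves (inj₂ rx) (inj₂ rx′) x≢x′

    apart : Apart (InSegment i k l false) (_≡ x′)
    apart (onPath _ y<k) refl = far-rightLeaf rx′ (<⇒≤ y<k) (<⇒≢ y<k) ∘ ClosedNbhd-sym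
    apart (onLeft _ ly)  refl = far-leaves (inj₁ ly) (inj₂ rx′) (leftLeaf≢rightLeaf ly rx′)

  inSegment-all : ∀ {u} → u < k + 5 → InSegment 0 (suc k) true true u
  inSegment-all {u} u<k+5 with u ≤? k
  ... | yes u≤k = onPath z≤n (s≤s u≤k)
  ... | no u≰k  = leaf (u ∸ k) (m+[n∸m]≡n (<⇒≤ (≰⇒> u≰k))) (≰⇒> u≰k) u<k+5
    where
    leaf : ∀ {u} d → k + d ≡ u → k < u → u < k + 5 → InSegment 0 (suc k) true true u
    leaf 0 refl k<k+0 _ = contradiction k<k+0 (<-irrefl (sym (+-identityʳ k)))
    leaf 1 refl _ _ = onLeft _ (inj₁ refl)
    leaf 2 refl _ _ = onLeft _ (inj₂ refl)
    leaf 3 refl _ _ = onRight _ (inj₁ refl)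
    leaf 4 refl _ _ = onRight _ (inj₂ refl)
    leaf (suc (suc (suc (suc (suc d))))) refl _ u<k+5 =
      contradiction (+-cancelˡ-< k _ _ u<k+5) λ { (s≤s (s≤s (s≤s (s≤s (s≤s ()))))) }

-- Option lists of segments

pred[m+n]≡pred[m]+n : ∀ {m n} → 0 < m → pred (m + n) ≡ pred m + n
pred[m+n]≡pred[m]+n {suc m} _ = refl

[m+o]∸[n+o]≡m∸n : ∀ m n o → (m + o) ∸ (n + o) ≡ m ∸ n
[m+o]∸[n+o]≡m∸n m n o = trans (cong₂ _∸_ (+-comm m o) (+-comm n o)) ([m+n]∸[m+o]≡n∸o o m n)

beyond-offset : ∀ {p q w} → p + q < w → ∃[ u ] p ≤ u × w ≡ suc (u + q)
beyond-offset {p} {q} {w} p+q<w =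
  w ∸ suc q , m+n≤o⇒m≤o∸n p p+1+q≤w , trans (sym (m∸n+n≡m (m+n≤o⇒n≤o p p+1+q≤w))) (+-suc (w ∸ suc q) q)
  where
  p+1+q≤w : p + suc q ≤ w
  p+1+q≤w = subst (_≤ w) (sym (+-suc p q)) p+q<w

-- piece false n stands for the Grundy value of the path on n vertices, piece true n
-- for that path with two extra leaves on its first vertex.  On a segment with n
-- spine vertices, playing the spine vertex at offset w leaves pieces of lengths
-- w ∸ 1 and n ∸ (w + 2); playing a leaf leaves its twin and a piece of length n ∸ 1.
module SegmentOptions (piece : Bool → ℕ → ℕ) where

  pathOption : Bool → Bool → ℕ → ℕ → ℕ
  pathOption l r n w = piece l (pred w) ⊕ piece r (n ∸ suc (suc w))

  leafOption : Bool → ℕ → List ℕ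
  leafOption b c = if b then c ∷ [] else []

  options : Bool → Bool → ℕ → List ℕ
  options l r n = map (pathOption l r n) (upTo n)
               ++ leafOption l (1 ⊕ piece r (pred n))
               ++ leafOption r (1 ⊕ piece l (pred n))

  data Option (l r : Bool) (n c : ℕ) : Set where
    atPath      : ∀ w → w < n → pathOption l r n w ≡ c → Option l r n c
    atLeftLeaf  : T l → 1 ⊕ piece r (pred n) ≡ c → Option l r n c
    atRightLeaf : T r → 1 ⊕ piece l (pred n) ≡ c → Option l r n c

  ∈-leafOption⁻ : ∀ {b c d} → d ∈ₗ leafOption b c → T b × c ≡ d
  ∈-leafOption⁻ {true} (here refl) = tt , refl

  ∈-leafOption⁺ : ∀ {b c} → T b → c ∈ₗ leafOption b c
  ∈-leafOption⁺ {true} _ = here refl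

  ∈-options⁻ : ∀ {l r n c} → c ∈ₗ options l r n → Option l r n c
  ∈-options⁻ {l} {r} {n} c∈ with ∈-++⁻ (map (pathOption l r n) (upTo n)) c∈
  ... | inj₁ c∈paths with ∈-map⁻ (pathOption l r n) c∈paths
  ...   | w , w∈ , refl = atPath w (∈-upTo⁻ w∈) refl
  ∈-options⁻ {l} {r} {n} c∈ | inj₂ c∈leaves with ∈-++⁻ (leafOption l (1 ⊕ piece r (pred n))) c∈leaves
  ... | inj₁ c∈left  = let (tl , eq) = ∈-leafOption⁻ c∈left in atLeftLeaf tl eq
  ... | inj₂ c∈right = let (tr , eq) = ∈-leafOption⁻ c∈right in atRightLeaf tr eq

  ∈-options⁺ : ∀ {l r n c} → Option l r n c → c ∈ₗ options l r n
  ∈-options⁺ (atPath w w<n refl) = ∈-++⁺ˡ (∈-map⁺ _ (∈-upTo⁺ w<n))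
  ∈-options⁺ {l} {r} {n} (atLeftLeaf tl refl) =
    ∈-++⁺ʳ (map (pathOption l r n) (upTo n)) (∈-++⁺ˡ (∈-leafOption⁺ tl))
  ∈-options⁺ {l} {r} {n} (atRightLeaf tr refl) =
    ∈-++⁺ʳ (map (pathOption l r n) (upTo n)) (∈-++⁺ʳ (leafOption l _) (∈-leafOption⁺ tr))

  mex-options-isMex : ∀ l r n → IsMex (Option l r n) (mex (options l r n))
  mex-options-isMex l r n = IsMex-resp (∈-options⁻ , ∈-options⁺) (mex-isMex (options l r n))

  Option-mirror : ∀ {l r n c} → Option l r n c → Option r l n c
  Option-mirror {l} {r} {n} (atPath w w<n refl) = atPath (n ∸ suc w) (mirror<n n w<n) (begin
    piece r (pred (n ∸ suc w)) ⊕ piece l (n ∸ suc (suc (n ∸ suc w)))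
      ≡⟨ cong₂ (λ a b → piece r a ⊕ piece l b) (pred[m∸n]≡m∸[1+n] n (suc w)) (n∸[2+[n∸[1+w]]]≡pred-w w<n) ⟩
    piece r (n ∸ suc (suc w)) ⊕ piece l (pred w)
      ≡⟨ ⊕-comm (piece r (n ∸ suc (suc w))) (piece l (pred w)) ⟩
    pathOption l r n w ∎)
    where
    open ≡-Reasoning
    mirror<n : ∀ n {w} → w < n → n ∸ suc w < n
    mirror<n (suc n) {w} _ = s≤s (m∸n≤m n w)
    n∸[2+[n∸[1+w]]]≡pred-w : ∀ {n w} → w < n → n ∸ suc (suc (n ∸ suc w)) ≡ pred w
    n∸[2+[n∸[1+w]]]≡pred-w {n} {w} w<n = begin
      n ∸ suc (suc d)            ≡⟨ cong (_∸ suc (suc d)) (sym (m+[n∸m]≡n w<n)) ⟩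
      (suc w + d) ∸ suc (suc d)  ≡⟨ cong₂ _∸_ (+-comm (suc w) d) (+-comm 2 d) ⟩
      (d + suc w) ∸ (d + 2)      ≡⟨ [m+n]∸[m+o]≡n∸o d (suc w) 2 ⟩
      pred w                     ∎
      where d = n ∸ suc w
  Option-mirror (atLeftLeaf tl eq)  = atRightLeaf tl eq
  Option-mirror (atRightLeaf tr eq) = atLeftLeaf tr eq

  module _ (piece-correct : ∀ b n → mex (options b false n) ≡ piece b n) where

    piece-zero : ∀ b → piece b 0 ≡ 0
    piece-zero false = sym (piece-correct false 0)
    piece-zero true  = trans (sym (piece-correct true 0)) (cong (λ a → mex (1 ⊕ a ∷ [])) (piece-zero false))

    piece-correctʳ : ∀ b n → mex (options false b n) ≡ piece b n
    piece-correctʳ b n = trans (IsMex-unique (mex-options-isMex false b n) mirrored) (piece-correct b n)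
      where
      mirrored : IsMex (Option false b n) (mex (options b false n))
      mirrored = IsMex-resp (Option-mirror , Option-mirror) (mex-options-isMex b false n)

  -- Lengthening a segment by q keeps its option set: a spine move at offset
  -- w ≤ pre l + q leaves a right piece beyond its preperiod, and a move further
  -- right corresponds to the move q places further left.
  module Shift (q : ℕ) (pre : Bool → ℕ) (periodic : ∀ b {n} → pre b ≤ n → piece b (n + q) ≡ piece b n)
               {l r : Bool} {m : ℕ} (bound : pre r + suc (suc (pre l + q)) ≤ m) where

    near : ∀ {w} → w ≤ pre l + q → pathOption l r (m + q) w ≡ pathOption l r m w
    near {w} w≤ = cong (piece l (pred w) ⊕_) (begin
      piece r (m + q ∸ suc (suc w))  ≡⟨ cong (piece r) (+-∸-comm q (m+n≤o⇒n≤o (pre r) pr+w+2≤m)) ⟩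
      piece r (m ∸ suc (suc w) + q)  ≡⟨ periodic r (m+n≤o⇒m≤o∸n (pre r) pr+w+2≤m) ⟩
      piece r (m ∸ suc (suc w))      ∎)
      where
      open ≡-Reasoning
      pr+w+2≤m : pre r + suc (suc w) ≤ m
      pr+w+2≤m = ≤-trans (+-monoʳ-≤ (pre r) (s≤s (s≤s w≤))) bound

    far : ∀ {u} → pre l ≤ u → pathOption l r (m + q) (suc (u + q)) ≡ pathOption l r m (suc u)
    far {u} pl≤u = cong₂ _⊕_ (periodic l pl≤u) (cong (piece r) ([m+o]∸[n+o]≡m∸n m (suc (suc (suc u))) q))

    w<m : ∀ {w} → w ≤ pre l + q → w < m
    w<m w≤ = ≤-trans (s≤s (≤-trans w≤ (n≤1+n _))) (m+n≤o⇒n≤o (pre r) bound)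

    pred-shift : ∀ b → pre b < m → piece b (pred (m + q)) ≡ piece b (pred m)
    pred-shift b pb<m =
      trans (cong (piece b) (pred[m+n]≡pred[m]+n (≤-trans (s≤s z≤n) pb<m))) (periodic b (<⇒≤pred pb<m))

    pre-r<m : pre r < m
    pre-r<m = ≤-trans (s≤s (m≤m+n (pre r) _)) (subst (_≤ m) (+-suc (pre r) _) bound)

    pre-l<m : pre l < m
    pre-l<m = ≤-trans (s≤s (m≤m+n (pre l) q)) (≤-trans (n≤1+n _) (m+n≤o⇒n≤o (pre r) bound))

    shift⁻ : ∀ {c} → Option l r (m + q) c → Option l r m c
    shift⁻ (atPath w w<m+q refl) with w ≤? pre l + q
    ... | yes w≤ = atPath w (w<m w≤) (sym (near w≤))
    ... | no w≰ with beyond-offset {pre l} {q} (≰⇒> w≰)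
    ...   | u , pl≤u , refl = atPath (suc u) (+-cancelʳ-< q (suc u) m w<m+q) (sym (far pl≤u))
    shift⁻ (atLeftLeaf tl eq)  = atLeftLeaf tl (trans (cong (1 ⊕_) (sym (pred-shift r pre-r<m))) eq)
    shift⁻ (atRightLeaf tr eq) = atRightLeaf tr (trans (cong (1 ⊕_) (sym (pred-shift l pre-l<m))) eq)

    shift⁺ : ∀ {c} → Option l r m c → Option l r (m + q) c
    shift⁺ (atPath zero 0<m refl) = atPath zero (≤-trans 0<m (m≤m+n m q)) (near z≤n)
    shift⁺ (atPath (suc u) u+1<m refl) with pre l ≤? u
    ... | yes pl≤u = atPath (suc (u + q)) (+-monoˡ-< q u+1<m) (far pl≤u)
    ... | no pl≰u  = atPath (suc u) (≤-trans u+1<m (m≤m+n m q)) (near (≤-trans (≰⇒> pl≰u) (m≤m+n (pre l) q)))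
    shift⁺ (atLeftLeaf tl eq)  = atLeftLeaf tl (trans (cong (1 ⊕_) (pred-shift r pre-r<m)) eq)
    shift⁺ (atRightLeaf tr eq) = atRightLeaf tr (trans (cong (1 ⊕_) (pred-shift l pre-l<m)) eq)

    mex-options-shift : mex (options l r (m + q)) ≡ mex (options l r m)
    mex-options-shift =
      IsMex-unique (IsMex-resp (shift⁻ , shift⁺) (mex-options-isMex l r (m + q))) (mex-options-isMex l r m)

-- Grundy values of segments

<∸⇒+< : ∀ i {j w} → w < j ∸ i → i + w < j
<∸⇒+< zero            w<j   = w<j
<∸⇒+< (suc i) {suc j} w<j∸i = s≤s (<∸⇒+< i w<j∸i)

partner : ∀ {a b x : ℕ} → a ≢ b → x ≡ a ⊎ x ≡ b → ∃[ y ] (y ≡ a ⊎ y ≡ b) × x ≢ y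
partner a≢b (inj₁ refl) = _ , inj₂ refl , a≢b
partner a≢b (inj₂ refl) = _ , inj₁ refl , a≢b ∘ sym

module SegmentGrundy (k : ℕ) (piece : Bool → ℕ → ℕ)
                     (piece-correct : ∀ b n → mex (SegmentOptions.options piece b false n) ≡ piece b n) where
  open T2PathT2 k
  open SegmentOptions piece
  open NodeKayles (T2pathT2 k) using (Position; play)

  value : Position → ℕ
  value = grundyOf (T2pathT2 k)

  leaf<k+5 : ∀ {x} → Leaf x → x < k + 5
  leaf<k+5 (inj₁ (inj₁ refl)) = +-monoʳ-< k (s≤s (s≤s z≤n))
  leaf<k+5 (inj₁ (inj₂ refl)) = +-monoʳ-< k (s≤s (s≤s (s≤s z≤n)))
  leaf<k+5 (inj₂ (inj₁ refl)) = +-monoʳ-< k (s≤s (s≤s (s≤s (s≤s z≤n))))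
  leaf<k+5 (inj₂ (inj₂ refl)) = +-monoʳ-< k ≤-refl

  spine<k+5 : ∀ {x} → x ≤ k → x < k + 5
  spine<k+5 x≤k = ≤-<-trans x≤k (m<m+n k z<s)

  vertexAt : ∀ {x} → x < k + 5 → ∃[ v ] toℕ v ≡ x
  vertexAt x<k+5 = fromℕ< x<k+5 , Fin.toℕ-fromℕ< x<k+5

  k+c≢k+d : ∀ {c d} → c ≢ d → k + c ≢ k + d
  k+c≢k+d c≢d = c≢d ∘ +-cancelˡ-≡ k _ _

  singleton-value : ∀ {x} → x < k + 5 → value ⟦ _≟ x ⟧ ≡ 1
  singleton-value x<k+5 =
    grundyOf-singleton (T2pathT2 k) (∈⟦⟧⁺ (_≟ _) (Fin.toℕ-fromℕ< x<k+5))
                       (λ u∈ → Fin.toℕ-injective (trans (∈⟦⟧⁻ (_≟ _) u∈) (sym (Fin.toℕ-fromℕ< x<k+5))))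

  -- A dropped pair of leaves only changes the flag of an empty piece, whose value is 0 either way.
  piece-keep : ∀ b {x c m} → (x ≡ c → m ≡ 0) → piece (b ∧ not (x ≡ᵇ c)) m ≡ piece b m
  piece-keep b {x} {c} m≡0 with x ≟ c
  ... | yes x≡c rewrite m≡0 x≡c = trans (piece-zero piece-correct _) (sym (piece-zero piece-correct b))
  ... | no x≢c  rewrite ¬T⇒≡false (x≢c ∘ ≡ᵇ⇒≡ x c) | ∧-identityʳ b = refl

  SmallerSegments : Position → Set
  SmallerSegments S = ∀ {i j l r} → WellFormed i j l r → ∣ segment i j l r ∣ < ∣ S ∣ →
                      value (segment i j l r) ≡ mex (options l r (j ∸ i))

  leftPiece-value : ∀ S {i j l} → SmallerSegments S → WellFormed i j l false →
                    ∣ segment i j l false ∣ < ∣ S ∣ → value (segment i j l false) ≡ piece l (j ∸ i)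
  leftPiece-value _ ih wf lt = trans (ih wf lt) (piece-correct _ _)

  rightPiece-value : ∀ S {i j r} → SmallerSegments S → WellFormed i j false r →
                     ∣ segment i j false r ∣ < ∣ S ∣ → value (segment i j false r) ≡ piece r (j ∸ i)
  rightPiece-value _ ih wf lt = trans (ih wf lt) (piece-correctʳ piece-correct _ _)

  pathMove-value : ∀ {i j l r} → WellFormed i j l r → SmallerSegments (segment i j l r) →
                   ∀ v → i ≤ toℕ v → toℕ v < j →
                   value (play (segment i j l r) v) ≡ pathOption l r (j ∸ i) (toℕ v ∸ i)
  pathMove-value {i} {j} {l} {r} wf ih v i≤x x<j =
    grundyOf-play-split (T2pathT2 k) {segment i j l r} {⟦ left? ⟧} {⟦ right? ⟧}
      (∈⟦⟧⁺ (inSegment? i j l r) (onPath i≤x x<j))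
      (play-⟦⟧ (inSegment? i j l r) left? right? v split join) (Apart⇒Separated left? right? apart)
      (λ lt → trans (leftPiece-value (segment i j l r) ih wfˡ lt) left-length)
      (λ lt → trans (rightPiece-value (segment i j l r) ih wfʳ lt) right-length)
    where
    open PathMove {v = toℕ v} wf i≤x x<j
    open WellFormed wf
    x = toℕ v
    left?  = inSegment? i (pred x) (keepLeft x l) false
    right? = inSegment? (suc (suc x)) j false (keepRight x r)

    wfˡ : WellFormed i (pred x) (keepLeft x l) false
    wfˡ = record { j≤1+k = ≤-trans pred[n]≤n (≤-trans v≤k (n≤1+n k))
                 ; left⇒i≡0 = left⇒i≡0 ∘ keepLeft⇒ {x}
                 ; right⇒j≡1+k = λ () }

    wfʳ : WellFormed (suc (suc x)) j false (keepRight x r)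
    wfʳ = record { j≤1+k = j≤1+k
                 ; left⇒i≡0 = λ ()
                 ; right⇒j≡1+k = right⇒j≡1+k ∘ keepRight⇒ {x} }

    left-length : piece (keepLeft x l) (pred x ∸ i) ≡ piece l (pred (x ∸ i))
    left-length = trans (piece-keep l {x} {0} (λ x≡0 → trans (cong (λ y → pred y ∸ i) x≡0) (0∸n≡0 i)))
                        (cong (piece l) (begin
      pred x ∸ i     ≡⟨ ∸-+-assoc x 1 i ⟩
      x ∸ suc i      ≡⟨ pred[m∸n]≡m∸[1+n] x i ⟨
      pred (x ∸ i)   ∎))
      where open ≡-Reasoning

    right-length : piece (keepRight x r) (j ∸ suc (suc x)) ≡ piece r ((j ∸ i) ∸ suc (suc (x ∸ i)))
    right-length = trans (piece-keep r {x} {k} (λ x≡k → m≤n⇒m∸n≡0 (≤-trans j≤1+k (1+k≤2+x x≡k))))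
                         (cong (piece r) (begin
      j ∸ suc (suc x)                  ≡⟨ cong (λ y → j ∸ suc (suc y)) (m+[n∸m]≡n i≤x) ⟨
      j ∸ suc (suc (i + (x ∸ i)))      ≡⟨ cong (j ∸_) (trans (+-suc i _) (cong suc (+-suc i _))) ⟨
      j ∸ (i + suc (suc (x ∸ i)))      ≡⟨ ∸-+-assoc j i _ ⟨
      (j ∸ i) ∸ suc (suc (x ∸ i))      ∎))
      where
      open ≡-Reasoning
      1+k≤2+x : x ≡ k → suc k ≤ suc (suc x)
      1+k≤2+x x≡k = subst (λ y → suc k ≤ suc (suc y)) (sym x≡k) (n≤1+n _)

  leftLeafMove-value : ∀ {i j l r} → WellFormed i j l r → SmallerSegments (segment i j l r) →
                       T l → ∀ v → LeftLeaf (toℕ v) →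
                       value (play (segment i j l r) v) ≡ 1 ⊕ piece r (pred (j ∸ i))
  leftLeafMove-value {j = j} {true} {r} wf ih _ v lv
    with refl ← WellFormed.left⇒i≡0 wf _ | x′ , lx′ , x≢x′ ← partner (k+c≢k+d λ ()) lv =
    grundyOf-play-split (T2pathT2 k) {segment 0 j true r} {⟦ _≟ x′ ⟧} {segment 1 j false r}
      (∈⟦⟧⁺ (inSegment? 0 j true r) (onLeft _ lv))
      (play-⟦⟧ (inSegment? 0 j true r) (_≟ x′) (inSegment? 1 j false r) v split join)
      (Apart⇒Separated (_≟ x′) (inSegment? 1 j false r) apart)
      (λ _ → singleton-value (leaf<k+5 (inj₁ lx′)))
      (rightPiece-value (segment 0 j true r) ih wfʳ)
    where
    open WellFormed wf
    open LeftLeafMove j≤1+k lv lx′ x≢x′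
    wfʳ : WellFormed 1 j false r
    wfʳ = record { j≤1+k = j≤1+k ; left⇒i≡0 = λ () ; right⇒j≡1+k = right⇒j≡1+k }

  rightLeafMove-value : ∀ {i j l r} → WellFormed i j l r → SmallerSegments (segment i j l r) →
                        T r → ∀ v → RightLeaf (toℕ v) →
                        value (play (segment i j l r) v) ≡ 1 ⊕ piece l (pred (j ∸ i))
  rightLeafMove-value {i} {l = l} {true} wf ih _ v rv
    with refl ← WellFormed.right⇒j≡1+k wf _ | x′ , rx′ , x≢x′ ← partner (k+c≢k+d λ ()) rv = begin
    value (play (segment i (suc k) l true) v)
      ≡⟨ grundyOf-play-split (T2pathT2 k) {segment i (suc k) l true} {segment i k l false} {⟦ _≟ x′ ⟧}
           (∈⟦⟧⁺ (inSegment? i (suc k) l true) (onRight _ rv))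
           (play-⟦⟧ (inSegment? i (suc k) l true) (inSegment? i k l false) (_≟ x′) v split join)
           (Apart⇒Separated (inSegment? i k l false) (_≟ x′) apart)
           (leftPiece-value (segment i (suc k) l true) ih wfˡ)
           (λ _ → singleton-value (leaf<k+5 (inj₂ rx′))) ⟩
    piece l (k ∸ i) ⊕ 1                   ≡⟨ ⊕-comm (piece l (k ∸ i)) 1 ⟩
    1 ⊕ piece l (k ∸ i)                   ≡⟨ cong (λ m → 1 ⊕ piece l m) (pred[m∸n]≡m∸[1+n] (suc k) i) ⟨
    1 ⊕ piece l (pred (suc k ∸ i))        ∎
    where
    open ≡-Reasoning
    open WellFormed wf
    open RightLeafMove rv rx′ x≢x′
    wfˡ : WellFormed i k l false
    wfˡ = record { j≤1+k = n≤1+n k ; left⇒i≡0 = left⇒i≡0 ; right⇒j≡1+k = λ () }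

  segment-value-step : ∀ {i j l r} → WellFormed i j l r → SmallerSegments (segment i j l r) →
                       value (segment i j l r) ≡ mex (options l r (j ∸ i))
  segment-value-step {i} {j} {l} {r} wf ih =
    grundyOf-unique (T2pathT2 k) (IsMex-resp (toMove , fromMove) (mex-options-isMex l r (j ∸ i)))
    where
    S = segment i j l r
    in-S : ∀ {v} → InSegment i j l r (toℕ v) → v ∈ S
    in-S = ∈⟦⟧⁺ (inSegment? i j l r)

    spineOption : ∀ {x} → i ≤ x → x < j → OptionValue (T2pathT2 k) S (pathOption l r (j ∸ i) (x ∸ i))
    spineOption i≤x x<j with vertexAt (spine<k+5 (≤-pred (≤-trans x<j (WellFormed.j≤1+k wf))))
    ... | v , refl = v , in-S (onPath i≤x x<j) , pathMove-value wf ih v i≤x x<j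

    toMove : ∀ {c} → Option l r (j ∸ i) c → OptionValue (T2pathT2 k) S c
    toMove (atPath w w<n refl) =
      subst (OptionValue (T2pathT2 k) S) (cong (pathOption l r (j ∸ i)) (m+n∸m≡n i w))
            (spineOption (m≤m+n i w) (<∸⇒+< i w<n))
    toMove (atLeftLeaf tl refl) with vertexAt (leaf<k+5 (inj₁ (inj₁ refl)))
    ... | v , tv = v , in-S (onLeft tl (inj₁ tv)) , leftLeafMove-value wf ih tl v (inj₁ tv)
    toMove (atRightLeaf tr refl) with vertexAt (leaf<k+5 (inj₂ (inj₁ refl)))
    ... | v , tv = v , in-S (onRight tr (inj₁ tv)) , rightLeafMove-value wf ih tr v (inj₁ tv)

    fromMove : ∀ {c} → OptionValue (T2pathT2 k) S c → Option l r (j ∸ i) c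
    fromMove (v , v∈S , refl) with ∈⟦⟧⁻ (inSegment? i j l r) v∈S
    ... | onPath i≤x x<j = atPath (toℕ v ∸ i) (∸-monoˡ-< x<j i≤x) (sym (pathMove-value wf ih v i≤x x<j))
    ... | onLeft tl lv   = atLeftLeaf tl (sym (leftLeafMove-value wf ih tl v lv))
    ... | onRight tr rv  = atRightLeaf tr (sym (rightLeafMove-value wf ih tr v rv))

  segment-value : ∀ {i j l r} → WellFormed i j l r → value (segment i j l r) ≡ mex (options l r (j ∸ i))
  segment-value wf = byFuel _ wf ≤-refl
    where
    byFuel : ∀ n {i j l r} → WellFormed i j l r → ∣ segment i j l r ∣ < n →
             value (segment i j l r) ≡ mex (options l r (j ∸ i))
    byFuel (suc n) wf ∣S∣<1+n =
      segment-value-step wf (λ wf′ lt → byFuel n wf′ (<-≤-trans lt (≤-pred ∣S∣<1+n)))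

  grundy-T2pathT2 : grundy (T2pathT2 k) ≡ mex (options true true (suc k))
  grundy-T2pathT2 = begin
    grundy (T2pathT2 k)                    ≡⟨ grundy≡grundyOf-all (T2pathT2 k) ⟩
    value (tabulate λ _ → true)            ≡⟨ cong value everything≡segment ⟩
    value (segment 0 (suc k) true true)    ≡⟨ segment-value wf ⟩
    mex (options true true (suc k))        ∎
    where
    open ≡-Reasoning
    wf : WellFormed 0 (suc k) true true
    wf = record { j≤1+k = ≤-refl ; left⇒i≡0 = λ _ → refl ; right⇒j≡1+k = λ _ → refl }
    everything≡segment : tabulate (λ _ → true) ≡ segment 0 (suc k) true true
    everything≡segment =
      ⊆-antisym (λ {u} _ → ∈⟦⟧⁺ (inSegment? 0 (suc k) true true) (inSegment-all (Fin.toℕ<n u)))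
                                   (λ _ → ∈-tabulate⁺ refl)

-- The computed tables

at : List ℕ → ℕ → ℕ
at []       _       = 0
at (x ∷ xs) zero    = x
at (x ∷ xs) (suc n) = at xs n

cycleIndex : ℕ → (q : ℕ) → .{{NonZero q}} → ℕ → ℕ
cycleIndex p q x = if x <ᵇ p then x else p + (x ∸ p) % q

≮⇒<ᵇ≡false : ∀ {m n} → ¬ m < n → (m <ᵇ n) ≡ false
≮⇒<ᵇ≡false {m} {n} m≮n = ¬T⇒≡false (m≮n ∘ <ᵇ⇒< m n)

cycleIndex-beyond : ∀ p q .{{_ : NonZero q}} {x} → p ≤ x → cycleIndex p q x ≡ p + (x ∸ p) % q
cycleIndex-beyond p q p≤x rewrite ≮⇒<ᵇ≡false (≤⇒≯ p≤x) = refl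

cycleIndex-periodic : ∀ p q .{{_ : NonZero q}} {x} → p ≤ x → cycleIndex p q (x + q) ≡ cycleIndex p q x
cycleIndex-periodic p q {x} p≤x = begin
  cycleIndex p q (x + q)   ≡⟨ cycleIndex-beyond p q (≤-trans p≤x (m≤m+n x q)) ⟩
  p + (x + q ∸ p) % q      ≡⟨ cong (λ y → p + y % q) (+-∸-comm q p≤x) ⟩
  p + (x ∸ p + q) % q      ≡⟨ cong (p +_) ([m+n]%n≡m%n (x ∸ p) q) ⟩
  p + (x ∸ p) % q          ≡⟨ cycleIndex-beyond p q p≤x ⟨
  cycleIndex p q x         ∎
  where open ≡-Reasoning

agree-if-periodic : ∀ {f g : ℕ → ℕ} p q → 0 < q → (∀ {n} → n < p + q → f n ≡ g n) →
                    (∀ {n} → p ≤ n → f (n + q) ≡ f n) → (∀ {n} → p ≤ n → g (n + q) ≡ g n) →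
                    ∀ n → f n ≡ g n
agree-if-periodic {f} {g} p q 0<q initial f-periodic g-periodic = <-rec _ agree
  where
  agree : ∀ n → (∀ {m} → m < n → f m ≡ g m) → f n ≡ g n
  agree n ih with n <? p + q
  ... | yes n<p+q = initial n<p+q
  ... | no n≮p+q  = begin
    f n        ≡⟨ cong f n≡m+q ⟩
    f (m + q)  ≡⟨ f-periodic p≤m ⟩
    f m        ≡⟨ ih m<n ⟩
    g m        ≡⟨ g-periodic p≤m ⟨
    g (m + q)  ≡⟨ cong g n≡m+q ⟨
    g n        ∎
    where
    open ≡-Reasoning
    m = n ∸ q
    p+q≤n = ≮⇒≥ n≮p+q
    n≡m+q : n ≡ m + q
    n≡m+q = sym (m∸n+n≡m (m+n≤o⇒n≤o p p+q≤n))
    p≤m : p ≤ m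
    p≤m = m+n≤o⇒m≤o∸n p p+q≤n
    m<n : m < n
    m<n = ∸-monoʳ-< 0<q (m+n≤o⇒n≤o p p+q≤n)

-- Grundy values of paths and of brooms with n spine vertices, for n up to the
-- end of their first period; the last line of each table is one period.
pathTable : List ℕ
pathTable =
    0 ∷ 1 ∷ 1 ∷ 2 ∷ 0 ∷ 3 ∷ 1 ∷ 1 ∷ 0 ∷ 3 ∷ 3 ∷ 2 ∷ 2 ∷ 4 ∷ 0 ∷ 5 ∷ 2 ∷ 2 ∷ 3 ∷ 3 ∷ 0 ∷ 1 ∷ 1 ∷ 3 ∷ 0 ∷ 2 ∷
    1 ∷ 1 ∷ 0 ∷ 4 ∷ 5 ∷ 2 ∷ 7 ∷ 4 ∷ 0 ∷ 1 ∷ 1 ∷ 2 ∷ 0 ∷ 3 ∷ 1 ∷ 1 ∷ 0 ∷ 3 ∷ 3 ∷ 2 ∷ 2 ∷ 4 ∷ 4 ∷ 5 ∷ 5 ∷ 2 ∷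
    3 ∷ 3 ∷ 0 ∷ 1 ∷ 1 ∷ 3 ∷ 0 ∷ 2 ∷ 1 ∷ 1 ∷ 0 ∷ 4 ∷ 5 ∷ 3 ∷ 7 ∷ 4 ∷ 8 ∷ 1 ∷ 1 ∷ 2 ∷ 0 ∷ 3 ∷ 1 ∷ 1 ∷ 0 ∷ 3 ∷ 3 ∷ 2 ∷ 2 ∷ 4 ∷ 4 ∷ 5 ∷ 5 ∷ 9 ∷
    []

broomTable : List ℕ
broomTable =
    0 ∷ 2 ∷ 1 ∷ 3 ∷ 0 ∷ 0 ∷ 1 ∷ 1 ∷ 4 ∷ 0 ∷ 5 ∷ 1 ∷ 1 ∷ 0 ∷ 0 ∷ 3 ∷ 1 ∷ 2 ∷ 0 ∷ 0 ∷ 1 ∷ 2 ∷ 2 ∷ 3 ∷ 3 ∷ 5 ∷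
    2 ∷ 4 ∷ 3 ∷ 3 ∷ 2 ∷ 2 ∷ 1 ∷ 0 ∷ 0 ∷ 2 ∷ 1 ∷ 3 ∷ 0 ∷ 0 ∷ 1 ∷ 7 ∷ 4 ∷ 4 ∷ 6 ∷ 5 ∷ 7 ∷ 0 ∷ 0 ∷ 3 ∷ 1 ∷ 2 ∷
    0 ∷ 0 ∷ 1 ∷ 2 ∷ 2 ∷ 4 ∷ 3 ∷ 5 ∷ 6 ∷ 4 ∷ 7 ∷ 3 ∷ 6 ∷ 2 ∷ 1 ∷ 0 ∷ 0 ∷ 2 ∷ 1 ∷ 3 ∷ 0 ∷ 8 ∷ 1 ∷ 9 ∷ 4 ∷ 2 ∷
    8 ∷ 5 ∷ 9 ∷ 4 ∷ 0 ∷ 3 ∷ 1 ∷ 2 ∷ 0 ∷ 0 ∷ 1 ∷ 2 ∷ 2 ∷ 4 ∷ 8 ∷ 5 ∷ 6 ∷ 4 ∷ 7 ∷ 8 ∷ 6 ∷ 9 ∷ 1 ∷ 0 ∷ 0 ∷ 2 ∷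
    1 ∷ 3 ∷ 0 ∷ 8 ∷ 1 ∷ 9 ∷ 4 ∷ 4 ∷ 8 ∷ 5 ∷ 9 ∷ 4 ∷ 0 ∷ 8 ∷ 1 ∷ 2 ∷ 0 ∷ 0 ∷ 1 ∷ 2 ∷ 2 ∷ 4 ∷ 8 ∷ 5 ∷ 9 ∷ 4 ∷
    12 ∷ 8 ∷ 6 ∷ 9 ∷ 9 ∷ 0 ∷ 0 ∷ 2 ∷ 1 ∷ 3 ∷ 0 ∷ 8 ∷ 1 ∷ 9 ∷ 4 ∷ 4 ∷ 14 ∷ 5 ∷ 13 ∷ 4 ∷ 0 ∷ 8 ∷ 1 ∷ 2 ∷ 0 ∷ 0 ∷
    1 ∷ 2 ∷ 2 ∷ 4 ∷ 8 ∷ 5 ∷ 9 ∷ 4 ∷ 12 ∷ 8 ∷ 6 ∷ 9 ∷ 9 ∷ 0 ∷ 0 ∷ 2 ∷ 1 ∷ 3 ∷ 0 ∷ 8 ∷ 1 ∷ 9 ∷ 4 ∷ 4 ∷ 14 ∷ 5 ∷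
    13 ∷ 4 ∷ 0 ∷ 8 ∷ 1 ∷ 2 ∷ 4 ∷ 0 ∷ 1 ∷ 2 ∷ 2 ∷ 4 ∷ 8 ∷ 5 ∷ 9 ∷ 4 ∷ 12 ∷ 8 ∷ 6 ∷ 9 ∷ 9 ∷ 0 ∷ 8 ∷ 2 ∷ 9 ∷ 3 ∷
    0 ∷ 8 ∷ 1 ∷ 9 ∷ 4 ∷ 4 ∷ 14 ∷ 5 ∷ 13 ∷ 4 ∷ 0 ∷ 8 ∷ 1 ∷ 2 ∷ 4 ∷ 0 ∷ 1 ∷ 2 ∷ 2 ∷ 4 ∷ 8 ∷ 5 ∷ 9 ∷ 4 ∷ 12 ∷ 8 ∷
    6 ∷ 9 ∷ 9 ∷ 0 ∷ 8 ∷ 2 ∷ 9 ∷ 3 ∷ 0 ∷ 8 ∷ 1 ∷ 9 ∷ 4 ∷ 4 ∷ 14 ∷ 5 ∷ 13 ∷ 4 ∷ 0 ∷ 8 ∷ 1 ∷ 2 ∷ 4 ∷ 0 ∷ 1 ∷ 2 ∷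
    2 ∷ 4 ∷ 8 ∷ 5 ∷ 9 ∷ 4 ∷ 12 ∷ 8 ∷ 6 ∷ 9 ∷ 9 ∷ 0 ∷ 8 ∷ 2 ∷ 9 ∷ 3 ∷ 0 ∷ 8 ∷ 1 ∷ 9 ∷ 4 ∷ 4 ∷ 14 ∷ 5 ∷ 13 ∷ 4 ∷
    0 ∷ 8 ∷ 1 ∷ 2 ∷ 4 ∷ 0 ∷ 5 ∷ 2 ∷ 2 ∷ 4 ∷ 8 ∷ 5 ∷ 9 ∷ 4 ∷ 12 ∷ 8 ∷ 6 ∷ 9 ∷ 9 ∷ 0 ∷ 8 ∷ 2 ∷ 9 ∷ 3 ∷ 15 ∷ 8 ∷
    1 ∷ 9 ∷ 4 ∷ 4 ∷ 14 ∷ 5 ∷ 13 ∷ 4 ∷ 0 ∷ 8 ∷ 1 ∷ 2 ∷ 4 ∷ 8 ∷ 5 ∷ 13 ∷ 2 ∷ 4 ∷ 8 ∷ 5 ∷ 9 ∷ 4 ∷ 12 ∷ 8 ∷ 6 ∷ 9 ∷ 9 ∷ 0 ∷ 8 ∷ 2 ∷ 9 ∷ 3 ∷ 15 ∷ 14 ∷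
    []

preperiod : Bool → ℕ
preperiod false = 52
preperiod true  = 312

table : Bool → List ℕ
table false = pathTable
table true  = broomTable

piece : Bool → ℕ → ℕ
piece b = at (table b) ∘ cycleIndex (preperiod b) 34

open SegmentOptions piece

piece-periodic : ∀ b {n} → preperiod b ≤ n → piece b (n + 34) ≡ piece b n
piece-periodic b p≤n = cong (at (table b)) (cycleIndex-periodic (preperiod b) 34 p≤n)

shiftBound : Bool → ℕ
shiftBound b = preperiod false + suc (suc (preperiod b + 34))

preperiod≤shiftBound : ∀ b → preperiod b ≤ shiftBound b
preperiod≤shiftBound b =
  ≤-trans (≤-trans (m≤m+n (preperiod b) 34) (≤-trans (n≤1+n _) (n≤1+n _))) (m≤n+m _ (preperiod false))

initial-check : ∀ b {n} → n < shiftBound b + 34 → mex (options b false n) ≡ piece b n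
initial-check false = toWitness {a? = allUpTo? (λ n → mex (options false false n) ≟ piece false n) 174} _
initial-check true  = toWitness {a? = allUpTo? (λ n → mex (options true false n) ≟ piece true n) 434} _

piece-correct : ∀ b n → mex (options b false n) ≡ piece b n
piece-correct b = agree-if-periodic (shiftBound b) 34 z<s (initial-check b)
  (Shift.mex-options-shift 34 preperiod piece-periodic {b} {false})
  (piece-periodic b ∘ ≤-trans (preperiod≤shiftBound b))

-- Below 660 = shift bound for leaves on both sides, periodicity is checked directly.
late-check : ∀ {n} → n < 660 → 642 ≤ n → mex (options true true (n + 34)) ≡ mex (options true true n)
late-check = toWitness {a? = allUpTo? (λ n → 642 ≤? n →-dec f (n + 34) ≟ f n) 660} _
  where
  f = mex ∘ options true true

mex-options-periodic : ∀ {n} → 642 ≤ n → mex (options true true (n + 34)) ≡ mex (options true true n)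
mex-options-periodic {n} 642≤n with n <? 660
... | yes n<660 = late-check n<660 642≤n
... | no n≮660  = Shift.mex-options-shift 34 preperiod piece-periodic {true} {true} (≮⇒≥ n≮660)

mainTheorem9 : (k : ℕ) → 641 ≤ k → grundy (T2pathT2 (k + 34)) ≡ grundy (T2pathT2 k)
mainTheorem9 k 641≤k = begin
  grundy (T2pathT2 (k + 34))            ≡⟨ grundy-T2pathT2 (k + 34) ⟩
  mex (options true true (suc k + 34))  ≡⟨ mex-options-periodic (s≤s 641≤k) ⟩
  mex (options true true (suc k))       ≡⟨ grundy-T2pathT2 k ⟨
  grundy (T2pathT2 k)                   ∎
  where
  open ≡-Reasoning
  grundy-T2pathT2 : ∀ k → grundy (T2pathT2 k) ≡ mex (options true true (suc k))
  grundy-T2pathT2 k = SegmentGrundy.grundy-T2pathT2 k piece piece-correct
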